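{- Let $V$ be a set of $n+1$ positive integers ($n\ge0$). The map $\mathrm{DP}$ is a bijection between the set of all valid digraphs on the node set $V$ and the set of all balanced Delannoy words of length $2n$.
   Context: Arrows: for a finite node set $V\subseteq\mathbb{P}$, an arrow $(x,y)$ with $x\ne y$ in $V$ has tail $x$ and head $y$; it is forward if $x<y$ and backward if $x>y$. Its interval is $\{\min(x,y),\ldots,\max(x,y)\}$. Two arrows cross if their intervals $[a_1,a_2]$, $[b_1,b_2]$ satisfy $a_1<b_1<a_2<b_2$ or $b_1<a_1<b_2<a_2$; an arrow nests another if its interval contains the other's interval; two arrows nest if one nests the other. A valid digraph on $V$ is a set $A$ of arrows on $V$ such that: (1) no two arrows cross; (2) any two forward arrows nest; (3) no backward arrow nests a forward arrow; (4) no head of an arrow is the tail of another arrow. For $W\subseteq V$, $A_W$ is the set of arrows of $A$ with both endpoints in $W$ (a digraph on $W$). Words: letters $U$, $D$ (length 1) and $H$ (length 2), encoding steps $(1,1)$, $(1,-1)$, $(2,0)$. A balanced Delannoy word of length $2n$ is a word of total length $2n$ with equally many $U$'s and $D$'s (i.e. encoding a path from $(0,0)$ to $(2n,0)$); a Schröder word is one whose path never goes below the horizontal axis. $\epsilon$ is the empty word; $\cdot$ is concatenation. $\mathrm{SP}$: for a valid digraph $A$ of backward arrows on nonempty $V$ with $v=\min V$: if $V=\{v\}$, $\mathrm{SP}(A)=\epsilon$; if $v$ is on no arrow, $\mathrm{SP}(A)=H\cdot\mathrm{SP}(A_{V-\{v\}})$; otherwise let $w=\min\{x\in V:(x,v)\in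 A\}$ and $\mathrm{SP}(A)=U\cdot\mathrm{SP}(A_{V\cap(v,w]})\cdot D\cdot\mathrm{SP}(A_{V-(v,w]})$. Twisting: if $A$ is a digraph on $V$ containing the forward arrow $(v,w)$ with $v=\min V$, $w=\max V$, then $\mathrm{tw}(A)$ is the digraph on $V-\{v\}$ with arrows $A_{V-\{v\}}\cup\{(w,z):(v,z)\in A\}$. $\mathrm{DP}$: for a valid digraph $A$ on $V$: if $A$ has no forward arrow, $\mathrm{DP}(A)=\mathrm{SP}(A)$; otherwise let $(x,y)$ be the forward arrow nesting all other forward arrows, $v=\min V$, $w=\max V$, and $\mathrm{DP}(A)=\mathrm{SP}(A_{V\cap[v,x]})\cdot D\cdot\mathrm{DP}(\mathrm{tw}(A_{V\cap[x,y]}))\cdot U\cdot\mathrm{SP}(A_{V\cap[y,w]})$. -}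

module Defs where

open import Data.Nat using (ℕ; zero; suc; _+_; _<_; _≤_; _⊓_; _⊔_; _<?_; _≤?_; _≟_)
open import Data.Nat.Properties using (<-cmp)
open import Data.Product using (_×_; _,_; proj₁; proj₂)
open import Data.Sum using (_⊎_)
open import Data.Bool using (Bool; true; false; not; _∧_; _∨_; if_then_else_)
open import Data.List using (List; []; _∷_; _++_; filter; length; foldr; map)
open import Data.Bool.ListAction using (any)
open import Data.List.Relation.Unary.All using (All)
open import Data.List.Relation.Unary.Linked using (Linked)
open import Data.List.Membership.Propositional using (_∈_)
open import Data.List.Membership.DecPropositional _≟_ using (_∈?_)
open import Relation.Nullary using (¬_)
open import Relation.Nullary.Decidable using (⌊_⌋)
open import Relation.Binary.PropositionalEquality using (_≡_)

-- Node sets: a finite set V ⊆ ℙ is represented canonically as the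
-- strictly increasing list of its elements, all positive.

NodeSet : List ℕ → Set
NodeSet V = Linked _<_ V × All (λ x → 0 < x) V

Arrow : Set
Arrow = ℕ × ℕ

tail head lo hi : Arrow → ℕ
tail a = proj₁ a
head a = proj₂ a
lo a = proj₁ a ⊓ proj₂ a
hi a = proj₁ a ⊔ proj₂ a

Forward Backward : Arrow → Set
Forward a = proj₁ a < proj₂ a
Backward a = proj₂ a < proj₁ a

Cross : Arrow → Arrow → Set
Cross a b = (lo a < lo b × lo b < hi a × hi a < hi b)
          ⊎ (lo b < lo a × lo a < hi b × hi b < hi a)

Nests : Arrow → Arrow → Set
Nests a b = lo a ≤ lo b × hi b ≤ hi a

_<ₐ_ : Arrow → Arrow → Set
(a , b) <ₐ (c , d) = a < c ⊎ (a ≡ c × b < d)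

-- A digraph (a finite set of arrows) is represented canonically as the
-- lexicographically strictly increasing list of its arrows.
Digraph : Set
Digraph = List Arrow

record ValidDigraph (V : List ℕ) (A : Digraph) : Set where
  field
    canonical : Linked _<ₐ_ A
    arrowsOnV : ∀ {a} → a ∈ A → tail a ∈ V × head a ∈ V × ¬ (tail a ≡ head a)
    noCross   : ∀ {a b} → a ∈ A → b ∈ A → ¬ Cross a b
    fwdNest   : ∀ {a b} → a ∈ A → b ∈ A → Forward a → Forward b → Nests a b ⊎ Nests b a
    noBackNestsFwd : ∀ {a b} → a ∈ A → b ∈ A → Backward a → Forward b → ¬ Nests a b
    headNotTail : ∀ {a b} → a ∈ A → b ∈ A → ¬ (head a ≡ tail b)

data Letter : Set where
  U D H : Letter

Word : Set
Word = List Letter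

wlen : Word → ℕ
wlen [] = 0
wlen (U ∷ w) = suc (wlen w)
wlen (D ∷ w) = suc (wlen w)
wlen (H ∷ w) = suc (suc (wlen w))

countU countD : Word → ℕ
countU [] = 0
countU (U ∷ w) = suc (countU w)
countU (_ ∷ w) = countU w
countD [] = 0
countD (D ∷ w) = suc (countD w)
countD (_ ∷ w) = countD w

BalancedDelannoy : ℕ → Word → Set
BalancedDelannoy n w = wlen w ≡ n + n × countU w ≡ countD w

boolFilter : {X : Set} → (X → Bool) → List X → List X
boolFilter p [] = []
boolFilter p (x ∷ xs) = if p x then x ∷ boolFilter p xs else boolFilter p xs

memb : ℕ → List ℕ → Bool
memb x W = ⌊ x ∈? W ⌋

restrict : List ℕ → Digraph → Digraph
restrict W A = boolFilter (λ a → memb (tail a) W ∧ memb (head a) W) A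

between : ℕ → ℕ → List ℕ → List ℕ
between a b V = boolFilter (λ z → ⌊ a ≤? z ⌋ ∧ ⌊ z ≤? b ⌋) V

minimum : ℕ → List ℕ → ℕ
minimum t ts = foldr _⊓_ t ts

-- SP, by recursion on a fuel bound (≥ size of the node set).

sp : ℕ → List ℕ → Digraph → Word
sp zero _ _ = []
sp (suc k) [] A = []
sp (suc k) (v ∷ []) A = []
sp (suc k) (v ∷ V'@(_ ∷ _)) A =
  if onArrow then branch (map tail (boolFilter (λ a → ⌊ head a ≟ v ⌋) A))
             else H ∷ sp k V' (restrict V' A)
  where
  V = v ∷ V'
  onArrow : Bool
  onArrow = any (λ a → ⌊ tail a ≟ v ⌋ ∨ ⌊ head a ≟ v ⌋) A
  branch : List ℕ → Word
  branch [] = []   -- cannot occur for valid digraphs of backward arrows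
  branch (t ∷ ts) =
    let w = minimum t ts
        I = boolFilter (λ z → ⌊ v <? z ⌋ ∧ ⌊ z ≤? w ⌋) V
        R = boolFilter (λ z → not (⌊ v <? z ⌋ ∧ ⌊ z ≤? w ⌋)) V
    in U ∷ sp k I (restrict I A) ++ D ∷ sp k R (restrict R A)

SP : List ℕ → Digraph → Word
SP V A = sp (length V) V A

forwards : Digraph → Digraph
forwards A = boolFilter (λ a → ⌊ tail a <? head a ⌋) A

nestsB : Arrow → Arrow → Bool
nestsB a b = ⌊ lo a ≤? lo b ⌋ ∧ ⌊ hi b ≤? hi a ⌋

-- the forward arrow nesting all others (for valid digraphs)
outermost : Arrow → Digraph → Arrow
outermost c [] = c
outermost c (a ∷ as) = outermost (if nestsB a c then a else c) as

-- twisting of a digraph A on node set M with min M = x, max M = y,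
-- result is a digraph on M - {x}  (the pair (y , y) is not an arrow and is omitted)
twistNodes : ℕ → List ℕ → List ℕ
twistNodes x M = boolFilter (λ z → ⌊ x <? z ⌋) M

twist : ℕ → ℕ → List ℕ → Digraph → Digraph
twist x y M A =
  restrict (twistNodes x M) A
  ++ map (λ a → (y , head a))
         (boolFilter (λ a → ⌊ tail a ≟ x ⌋ ∧ not ⌊ head a ≟ y ⌋) A)

dp : ℕ → List ℕ → Digraph → Word
dp zero _ _ = []
dp (suc k) V A with forwards A
... | [] = SP V A
... | f ∷ fs =
  let xy = outermost f fs
      x = tail xy
      y = head xy
      M = between x y V
      L = boolFilter (λ z → ⌊ z ≤? x ⌋) V
      R = boolFilter (λ z → ⌊ y ≤? z ⌋) V
  in SP L (restrict L A) ++ D ∷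
       dp k (twistNodes x M) (twist x y M (restrict M A))
     ++ U ∷ SP R (restrict R A)

DP : List ℕ → Digraph → Word
DP V A = dp (length V) V A

-- A valid digraph without forward arrows is read off by SP along its first-return structure:
-- either min V lies on no arrow (a letter H), or the shortest arrow (w , min V) into min V
-- splits the other arrows into those inside (min V , w] and those outside, giving
-- U · SP(inside) · D · SP(outside).  Conversely the first-return factorisation U s₁ D s₂ of a
-- Schröder word determines w as the node of rank |s₁|/2 + 1 above min V, so SP is a
-- bijection onto Schröder words of the right length.
-- With forward arrows, the outermost one (x , y) cuts V into a left part ≤ x and a right part
-- ≥ y, both carrying only backward arrows, and the middle part on [x , y], which twisting
-- turns into a valid digraph on one node fewer.  Every balanced Delannoy word is either a
-- Schröder word or factors uniquely as s₁ D m U s₂ with s₁ , s₂ Schröder (first descent below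
-- the axis, and the same for the reflected word), and the lengths of s₁ and s₁ D m recover
-- x and y.  So DP is a bijection by induction on |V|, granted that twisting is invertible.
-- Digraphs are compared up to having the same arrows (_≐_); the sorted list required by
-- ValidDigraph is restored only at the very end.

module Submission where

open import Defs
open import Data.Nat using (ℕ; zero; suc; _+_; _∸_; _<_; _≤_; _⊓_; _⊔_; _<?_; _≤?_; _≟_; z≤n; s≤s)
open import Data.Nat.Properties
open import Data.Nat.Tactic.RingSolver using (solve-∀)
open import Data.Product using (_×_; _,_; proj₁; proj₂; ∃; ∃-syntax)
open import Data.Product.Properties using (,-injective; ≡-dec)
open import Data.Sum using (_⊎_; inj₁; inj₂)
open import Data.Bool using (Bool; true; false; not; _∧_; _∨_)
open import Data.Unit using (⊤; tt)
open import Data.Empty using (⊥; ⊥-elim)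
open import Data.Maybe using (Maybe; just; nothing)
open import Data.Maybe.Properties using (just-injective)
open import Data.List using (List; []; _∷_; _++_; length; map)
open import Data.List.Properties using (++-assoc; ++-identityʳ; ∷-injective)
open import Data.Bool.ListAction using (any)
open import Data.List.Relation.Unary.Any using (here; there)
open import Data.List.Relation.Unary.All using (lookup)
open import Data.List.Relation.Unary.Linked using (Linked; []; [-]; _∷_)
open import Data.List.Relation.Unary.Linked.Properties using (Linked⇒All)
open import Data.List.Relation.Binary.Subset.Propositional using (_⊆_)
open import Data.List.Membership.Propositional using (_∈_)
open import Data.List.Membership.Propositional.Properties using (∈-++⁺ˡ; ∈-++⁺ʳ; ∈-++⁻; ∈-map⁺; ∈-map⁻)
open import Data.List.Membership.DecPropositional _≟_ using (_∈?_)
import Data.List.Membership.DecPropositional as DecMembership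
open import Relation.Nullary using (¬_; Dec; yes; no)
open import Relation.Nullary.Decidable using (⌊_⌋)
open import Relation.Binary.Definitions using (Transitive; tri<; tri≈; tri>)
open import Relation.Binary.PropositionalEquality using (_≡_; _≢_; refl; sym; trans; cong; cong₂; subst; subst₂; module ≡-Reasoning)

module _ {p} {P : Set p} where
  ⌊⌋-true : (d : Dec P) → P → ⌊ d ⌋ ≡ true
  ⌊⌋-true (yes _) _ = refl
  ⌊⌋-true (no ¬p) x = ⊥-elim (¬p x)

  ⌊⌋-true⁻ : (d : Dec P) → ⌊ d ⌋ ≡ true → P
  ⌊⌋-true⁻ (yes x) _ = x

  ⌊⌋-false : (d : Dec P) → ¬ P → ⌊ d ⌋ ≡ false
  ⌊⌋-false (yes x) ¬p = ⊥-elim (¬p x)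
  ⌊⌋-false (no _) _ = refl

  ⌊⌋-false⁻ : (d : Dec P) → ⌊ d ⌋ ≡ false → ¬ P
  ⌊⌋-false⁻ (no ¬p) _ = ¬p

∧-true⁻ : ∀ {a b} → a ∧ b ≡ true → a ≡ true × b ≡ true
∧-true⁻ {true} {true} refl = refl , refl

∧-true⁺ : ∀ {a b} → a ≡ true → b ≡ true → a ∧ b ≡ true
∧-true⁺ refl refl = refl

∧-falseʳ : ∀ a {b} → b ≡ false → a ∧ b ≡ false
∧-falseʳ true refl = refl
∧-falseʳ false refl = refl

not-true⁻ : ∀ {a} → not a ≡ true → a ≡ false
not-true⁻ {false} _ = refl

not-true⁺ : ∀ {a} → a ≡ false → not a ≡ true
not-true⁺ refl = refl

not-false⁺ : ∀ {b} → b ≡ true → not b ≡ false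
not-false⁺ refl = refl

true-or-false : ∀ b → b ≡ true ⊎ b ≡ false
true-or-false true = inj₁ refl
true-or-false false = inj₂ refl

true≢false : ∀ {b} → b ≡ true → b ≡ false → ⊥
true≢false refl ()

module _ {p q} {P : Set p} {Q : Set q} where
  ⌊⌋∧⌊⌋-true : (d₁ : Dec P) (d₂ : Dec Q) → P → Q → ⌊ d₁ ⌋ ∧ ⌊ d₂ ⌋ ≡ true
  ⌊⌋∧⌊⌋-true d₁ d₂ x y = ∧-true⁺ (⌊⌋-true d₁ x) (⌊⌋-true d₂ y)

  ⌊⌋∧⌊⌋-true⁻ : (d₁ : Dec P) (d₂ : Dec Q) → ⌊ d₁ ⌋ ∧ ⌊ d₂ ⌋ ≡ true → P × Q
  ⌊⌋∧⌊⌋-true⁻ d₁ d₂ e = ⌊⌋-true⁻ d₁ (proj₁ (∧-true⁻ e)) , ⌊⌋-true⁻ d₂ (proj₂ (∧-true⁻ e))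

  ⌊⌋∧⌊⌋-false : (d₁ : Dec P) (d₂ : Dec Q) → ¬ (P × Q) → ⌊ d₁ ⌋ ∧ ⌊ d₂ ⌋ ≡ false
  ⌊⌋∧⌊⌋-false (yes x) (yes y) h = ⊥-elim (h (x , y))
  ⌊⌋∧⌊⌋-false (yes x) (no _) h = refl
  ⌊⌋∧⌊⌋-false (no _) d₂ h = refl

  ⌊⌋∧⌊⌋-false⁻ : (d₁ : Dec P) (d₂ : Dec Q) → ⌊ d₁ ⌋ ∧ ⌊ d₂ ⌋ ≡ false → ¬ (P × Q)
  ⌊⌋∧⌊⌋-false⁻ (yes x) (no ¬y) _ (_ , y) = ¬y y
  ⌊⌋∧⌊⌋-false⁻ (no ¬x) d₂ _ (x , _) = ¬x x

module _ {X : Set} where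
  boolFilter⁺ : (p : X → Bool) {l : List X} {a : X} → a ∈ l → p a ≡ true → a ∈ boolFilter p l
  boolFilter⁺ p {x ∷ l} (here refl) e rewrite e = here refl
  boolFilter⁺ p {x ∷ l} (there m) e with p x
  ... | true = there (boolFilter⁺ p m e)
  ... | false = boolFilter⁺ p m e

  boolFilter⁻ : (p : X → Bool) {l : List X} {a : X} → a ∈ boolFilter p l → a ∈ l × p a ≡ true
  boolFilter⁻ p {x ∷ l} m with p x in eq
  boolFilter⁻ p {x ∷ l} (here refl) | true = here refl , eq
  boolFilter⁻ p {x ∷ l} (there m) | true = there (proj₁ (boolFilter⁻ p {l} m)) , proj₂ (boolFilter⁻ p {l} m)
  boolFilter⁻ p {x ∷ l} m | false = there (proj₁ (boolFilter⁻ p {l} m)) , proj₂ (boolFilter⁻ p {l} m)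

  boolFilter-cong : (p q : X → Bool) (l : List X) → (∀ {a} → a ∈ l → p a ≡ q a) → boolFilter p l ≡ boolFilter q l
  boolFilter-cong p q [] h = refl
  boolFilter-cong p q (x ∷ l) h rewrite h (here refl) with q x
  ... | true = cong (x ∷_) (boolFilter-cong p q l (λ m → h (there m)))
  ... | false = boolFilter-cong p q l (λ m → h (there m))

  boolFilter-boolFilter : (p q : X → Bool) (l : List X) → boolFilter p (boolFilter q l) ≡ boolFilter (λ a → q a ∧ p a) l
  boolFilter-boolFilter p q [] = refl
  boolFilter-boolFilter p q (x ∷ l) with q x
  ... | false = boolFilter-boolFilter p q l
  ... | true with p x
  ...   | true = cong (x ∷_) (boolFilter-boolFilter p q l)
  ...   | false = boolFilter-boolFilter p q l

  length-boolFilter-partition : (p : X → Bool) (l : List X) → length (boolFilter p l) + length (boolFilter (λ a → not (p a)) l) ≡ length l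
  length-boolFilter-partition p [] = refl
  length-boolFilter-partition p (x ∷ l) with p x
  ... | true = cong suc (length-boolFilter-partition p l)
  ... | false = trans (+-suc (length (boolFilter p l)) _) (cong suc (length-boolFilter-partition p l))

  boolFilter-all : (p : X → Bool) (l : List X) → (∀ {a} → a ∈ l → p a ≡ true) → boolFilter p l ≡ l
  boolFilter-all p [] h = refl
  boolFilter-all p (x ∷ l) h rewrite h (here refl) = cong (x ∷_) (boolFilter-all p l (λ m → h (there m)))

  boolFilter-none : (p : X → Bool) (l : List X) → (∀ {a} → a ∈ l → p a ≡ false) → boolFilter p l ≡ []
  boolFilter-none p [] h = refl
  boolFilter-none p (x ∷ l) h rewrite h (here refl) = boolFilter-none p l (λ m → h (there m))

  length-boolFilter≤ : (p : X → Bool) (l : List X) → length (boolFilter p l) ≤ length l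
  length-boolFilter≤ p [] = z≤n
  length-boolFilter≤ p (x ∷ l) with p x
  ... | true = s≤s (length-boolFilter≤ p l)
  ... | false = m≤n⇒m≤1+n (length-boolFilter≤ p l)

  length-boolFilter< : (p : X → Bool) (l : List X) {a : X} → a ∈ l → p a ≡ false → length (boolFilter p l) < length l
  length-boolFilter< p (x ∷ l) (here refl) e rewrite e = s≤s (length-boolFilter≤ p l)
  length-boolFilter< p (x ∷ l) (there m) e with p x
  ... | true = s≤s (length-boolFilter< p l m e)
  ... | false = m≤n⇒m≤1+n (length-boolFilter< p l m e)

  length-boolFilter-mono : (p q : X → Bool) (l : List X) → (∀ {a} → a ∈ l → p a ≡ true → q a ≡ true) → length (boolFilter p l) ≤ length (boolFilter q l)
  length-boolFilter-mono p q [] h = z≤n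
  length-boolFilter-mono p q (x ∷ l) h with p x in ep | q x in eq
  ... | true | true = s≤s (length-boolFilter-mono p q l (λ m → h (there m)))
  ... | true | false = ⊥-elim (true≢false (h (here refl) ep) eq)
  ... | false | true = m≤n⇒m≤1+n (length-boolFilter-mono p q l (λ m → h (there m)))
  ... | false | false = length-boolFilter-mono p q l (λ m → h (there m))

  length-boolFilter-strictMono : (p q : X → Bool) (l : List X) → (∀ {a} → a ∈ l → p a ≡ true → q a ≡ true) → {b : X} → b ∈ l → p b ≡ false → q b ≡ true → length (boolFilter p l) < length (boolFilter q l)
  length-boolFilter-strictMono p q (x ∷ l) h (here refl) e1 e2 rewrite e1 | e2 = s≤s (length-boolFilter-mono p q l (λ m → h (there m)))
  length-boolFilter-strictMono p q (x ∷ l) h (there bm) e1 e2 with p x in ep | q x in eq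
  ... | true | true = s≤s (length-boolFilter-strictMono p q l (λ m → h (there m)) bm e1 e2)
  ... | true | false = ⊥-elim (true≢false (h (here refl) ep) eq)
  ... | false | true = m≤n⇒m≤1+n (length-boolFilter-strictMono p q l (λ m → h (there m)) bm e1 e2)
  ... | false | false = length-boolFilter-strictMono p q l (λ m → h (there m)) bm e1 e2

infix 4 _≐_

_≐_ : {X : Set} → List X → List X → Set
A ≐ B = A ⊆ B × B ⊆ A

module _ {X : Set} where
  ≐-sym : {A B : List X} → A ≐ B → B ≐ A
  ≐-sym (f , g) = g , f

  ≐-trans : {A B C : List X} → A ≐ B → B ≐ C → A ≐ C
  ≐-trans (f , g) (f' , g') = (λ m → f' (f m)) , (λ m → g (g' m))

memb⁻ : ∀ {x W} → memb x W ≡ true → x ∈ W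
memb⁻ {x} {W} e = ⌊⌋-true⁻ (x ∈? W) e

memb⁺ : ∀ {x W} → x ∈ W → memb x W ≡ true
memb⁺ {x} {W} m = ⌊⌋-true (x ∈? W) m

restrict⁺ : ∀ {W A a} → a ∈ A → tail a ∈ W → head a ∈ W → a ∈ restrict W A
restrict⁺ {W} {A} {a} m t h = boolFilter⁺ (λ a → memb (tail a) W ∧ memb (head a) W) m (∧-true⁺ (memb⁺ t) (memb⁺ h))

restrict⁻ : ∀ {W A a} → a ∈ restrict W A → a ∈ A × tail a ∈ W × head a ∈ W
restrict⁻ {W} {A} {a} m with boolFilter⁻ (λ a → memb (tail a) W ∧ memb (head a) W) {A} m
... | m' , e = m' , memb⁻ (proj₁ (∧-true⁻ e)) , memb⁻ (proj₂ (∧-true⁻ e))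

restrict-≐ : ∀ W {A B} → A ≐ B → restrict W A ≐ restrict W B
restrict-≐ W {A} {B} (f , g) = (λ m → let (m1 , t , h) = restrict⁻ {W} {A} m in restrict⁺ (f m1) t h) , (λ m → let (m1 , t , h) = restrict⁻ {W} {B} m in restrict⁺ (g m1) t h)

restrict-⊆ : ∀ {W A} → restrict W A ⊆ A
restrict-⊆ {W} {A} m = proj₁ (restrict⁻ {W} {A} m)

Increasing : {X : Set} → (X → X → Set) → List X → Set
Increasing _≺_ [] = ⊤
Increasing _≺_ (x ∷ xs) = (∀ {z} → z ∈ xs → x ≺ z) × Increasing _≺_ xs

module _ {X : Set} {_≺_ : X → X → Set} where
  Linked⇒Increasing : Transitive _≺_ → ∀ {xs} → Linked _≺_ xs → Increasing _≺_ xs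
  Linked⇒Increasing ≺-trans [] = tt
  Linked⇒Increasing ≺-trans [-] = (λ ()) , tt
  Linked⇒Increasing ≺-trans (l ∷ ls) = lookup (Linked⇒All ≺-trans l ls) , Linked⇒Increasing ≺-trans ls

  Increasing⇒Linked : ∀ {xs} → Increasing _≺_ xs → Linked _≺_ xs
  Increasing⇒Linked {[]} _ = []
  Increasing⇒Linked {x ∷ []} _ = [-]
  Increasing⇒Linked {x ∷ y ∷ xs} (h , s) = h (here refl) ∷ Increasing⇒Linked s

  Increasing-boolFilter : ∀ p xs → Increasing _≺_ xs → Increasing _≺_ (boolFilter p xs)
  Increasing-boolFilter p [] s = s
  Increasing-boolFilter p (x ∷ xs) (h , s) with p x
  ... | true = (λ m → h (proj₁ (boolFilter⁻ p {xs} m))) , Increasing-boolFilter p xs s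
  ... | false = Increasing-boolFilter p xs s

Sorted : List ℕ → Set
Sorted = Increasing _<_

Sorted-head : ∀ {v V' z} → Sorted (v ∷ V') → z ∈ v ∷ V' → v ≡ z ⊎ v < z
Sorted-head s (here refl) = inj₁ refl
Sorted-head (h , _) (there m) = inj₂ (h m)

Sorted-head≤ : ∀ {v V' z} → Sorted (v ∷ V') → z ∈ v ∷ V' → v ≤ z
Sorted-head≤ s m with Sorted-head s m
... | inj₁ refl = ≤-refl
... | inj₂ l = <⇒≤ l

module _ {X : Set} where
  any-true⁻ : (p : X → Bool) (l : List X) → any p l ≡ true → ∃[ a ] (a ∈ l × p a ≡ true)
  any-true⁻ p (x ∷ l) e with p x in ex
  ... | true = x , here refl , ex
  ... | false with any-true⁻ p l e
  ...   | a , m , e' = a , there m , e'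

  any-true⁺ : (p : X → Bool) {l : List X} {a : X} → a ∈ l → p a ≡ true → any p l ≡ true
  any-true⁺ p {x ∷ l} (here refl) e rewrite e = refl
  any-true⁺ p {x ∷ l} (there m) e with p x
  ... | true = refl
  ... | false = any-true⁺ p m e

  any-false⁻ : (p : X → Bool) {l : List X} {a : X} → any p l ≡ false → a ∈ l → p a ≡ false
  any-false⁻ p {x ∷ l} e (here refl) with p x
  ... | false = refl
  any-false⁻ p {x ∷ l} e (there m) with p x
  ... | false = any-false⁻ p e m

  any-≐ : (p : X → Bool) {A B : List X} → A ≐ B → any p A ≡ any p B
  any-≐ p {A} {B} (f , g) with true-or-false (any p A) | true-or-false (any p B)
  ... | inj₁ x | inj₁ y = trans x (sym y)
  ... | inj₂ x | inj₂ y = trans x (sym y)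
  ... | inj₁ x | inj₂ y = let (a , m , e) = any-true⁻ p A x in ⊥-elim (true≢false e (any-false⁻ p y (f m)))
  ... | inj₂ x | inj₁ y = let (a , m , e) = any-true⁻ p B y in ⊥-elim (true≢false e (any-false⁻ p x (g m)))

∨-true⁻ : ∀ {a b} → a ∨ b ≡ true → a ≡ true ⊎ b ≡ true
∨-true⁻ {true} _ = inj₁ refl
∨-true⁻ {false} e = inj₂ e

∨-false⁻ : ∀ {a b} → a ∨ b ≡ false → a ≡ false × b ≡ false
∨-false⁻ {false} e = refl , e

∨-trueʳ : ∀ a {b} → b ≡ true → a ∨ b ≡ true
∨-trueʳ true _ = refl
∨-trueʳ false e = e

minimum-∈ : ∀ t ts → minimum t ts ≡ t ⊎ minimum t ts ∈ ts
minimum-∈ t [] = inj₁ refl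
minimum-∈ t (x ∷ xs) with ⊓-sel x (minimum t xs)
... | inj₁ e = inj₂ (here e)
... | inj₂ e rewrite e with minimum-∈ t xs
...   | inj₁ e' = inj₁ e'
...   | inj₂ m = inj₂ (there m)

minimum-≤ : ∀ t ts {z} → z ∈ t ∷ ts → minimum t ts ≤ z
minimum-≤ t [] (here refl) = ≤-refl
minimum-≤ t (x ∷ xs) (here refl) = ≤-trans (m⊓n≤n x (minimum t xs)) (minimum-≤ t xs (here refl))
minimum-≤ t (x ∷ xs) (there (here refl)) = m⊓n≤m x (minimum t xs)
minimum-≤ t (x ∷ xs) (there (there m)) = ≤-trans (m⊓n≤n x (minimum t xs)) (minimum-≤ t xs (there m))

∈-tail : ∀ {z v} {X : List ℕ} → z ∈ v ∷ X → z ≢ v → z ∈ X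
∈-tail (here e) ne = ⊥-elim (ne e)
∈-tail (there m) _ = m

∈-skipSecond : ∀ {X : Set} {x y z : X} {xs} → z ∈ x ∷ xs → z ∈ x ∷ y ∷ xs
∈-skipSecond (here e) = here e
∈-skipSecond (there m) = there (there m)

∈⇒length-suc : ∀ {X : Set} {l : List X} {a : X} → a ∈ l → ∃[ i ] (length l ≡ suc i)
∈⇒length-suc {l = x ∷ l} _ = length l , refl

-- Lattice paths and balanced words

data Path : ℕ → ℕ → Word → Set where
  pnil : ∀ {a} → Path a a []
  pH : ∀ {a b w} → Path a b w → Path a b (H ∷ w)
  pU : ∀ {a b w} → Path (suc a) b w → Path a b (U ∷ w)
  pD : ∀ {a b w} → Path a b w → Path (suc a) b (D ∷ w)

Path-lift : ∀ {a b w} → Path a b w → Path (suc a) (suc b) w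
Path-lift pnil = pnil
Path-lift (pH p) = pH (Path-lift p)
Path-lift (pU p) = pU (Path-lift p)
Path-lift (pD p) = pD (Path-lift p)

Path-++ : ∀ {a b c s r} → Path a b s → Path b c r → Path a c (s ++ r)
Path-++ pnil q = q
Path-++ (pH p) q = pH (Path-++ p q)
Path-++ (pU p) q = pU (Path-++ p q)
Path-++ (pD p) q = pD (Path-++ p q)

Schröder : Word → Set
Schröder w = Path 0 0 w

Schröder-UD : ∀ {s1 s2} → Schröder s1 → Schröder s2 → Schröder (U ∷ s1 ++ D ∷ s2)
Schröder-UD p q = pU (Path-++ (Path-lift p) (pD q))

length-D-suffix : ∀ (x y : Word) → length y ≤ length (x ++ D ∷ y)
length-D-suffix [] y = m≤n⇒m≤1+n ≤-refl
length-D-suffix (c ∷ x) y = m≤n⇒m≤1+n (length-D-suffix x y)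

split-first-return : ∀ f {k b w} → length w ≤ f → Path (suc k) b w → b ≤ k →
         ∃[ s1 ] ∃[ s2 ] (w ≡ s1 ++ D ∷ s2 × Schröder s1 × Path k b s2)
split-first-return f l pnil b≤k = ⊥-elim (<-irrefl refl b≤k)
split-first-return (suc f) (s≤s l) (pH p) b≤k with split-first-return f l p b≤k
... | s1 , s2 , refl , q1 , q2 = H ∷ s1 , s2 , refl , pH q1 , q2
split-first-return (suc f) {k} {b} (s≤s l) (pU {w = w} p) b≤k with split-first-return f l p (m≤n⇒m≤1+n b≤k)
... | s1 , s2 , refl , q1 , q2 with split-first-return f (≤-trans (length-D-suffix s1 s2) l) q2 b≤k
...   | t1 , t2 , refl , r1 , r2 = U ∷ s1 ++ D ∷ t1 , t2 , cong (U ∷_) (sym (++-assoc s1 (D ∷ t1) (D ∷ t2))) , Schröder-UD q1 r1 , r2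
split-first-return (suc f) (s≤s l) (pD p) b≤k = [] , _ , refl , pnil , p

data SchröderView : Word → Set where
  vnil : SchröderView []
  vH : ∀ {w} → Schröder w → SchröderView (H ∷ w)
  vU : ∀ {s1 s2} → Schröder s1 → Schröder s2 → SchröderView (U ∷ s1 ++ D ∷ s2)

schröderView : ∀ {w} → Schröder w → SchröderView w
schröderView pnil = vnil
schröderView (pH p) = vH p
schröderView (pU {w = w} p) with split-first-return (length w) ≤-refl p z≤n
... | s1 , s2 , refl , q1 , q2 = vU q1 q2

countH : Word → ℕ
countH [] = 0
countH (H ∷ w) = suc (countH w)
countH (_ ∷ w) = countH w

wlen-count : ∀ w → wlen w ≡ countU w + countD w + (countH w + countH w)
wlen-count [] = refl
wlen-count (U ∷ w) = cong suc (wlen-count w)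
wlen-count (D ∷ w) = trans (cong suc (wlen-count w)) (cong (_+ (countH w + countH w)) (sym (+-suc (countU w) (countD w))))
wlen-count (H ∷ w) rewrite wlen-count w = shift (countU w + countD w) (countH w)
  where
  shift : ∀ a h → suc (suc (a + (h + h))) ≡ a + (suc h + suc h)
  shift = solve-∀

Path-count : ∀ {a b w} → Path a b w → a + countU w ≡ b + countD w
Path-count pnil = refl
Path-count (pH p) = Path-count p
Path-count {a} {b} {U ∷ w} (pU p) = trans (+-suc a (countU w)) (Path-count p)
Path-count {suc a} {b} {D ∷ w} (pD p) = trans (cong suc (Path-count p)) (sym (+-suc b (countD w)))

Schröder-balanced : ∀ {w} → Schröder w → countU w ≡ countD w
Schröder-balanced p = Path-count p

Path-balanced : ∀ {a b w} → Path a b w → countU w ≡ countD w → a ≡ b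
Path-balanced {a} {b} {w} p bal = +-cancelʳ-≡ (countD w) a b (trans (cong (a +_) (sym bal)) (Path-count p))

¬Path-excess-U : ∀ {b r} → countU r ≡ suc (countD r) → ¬ Path b 0 r
¬Path-excess-U {b} {r} excess q = <-irrefl refl (begin-strict
  countD r          <⟨ n<1+n (countD r) ⟩
  suc (countD r)    ≤⟨ m≤n+m (suc (countD r)) b ⟩
  b + suc (countD r) ≡⟨ cong (b +_) (sym excess) ⟩
  b + countU r      ≡⟨ Path-count q ⟩
  countD r          ∎)
  where open ≤-Reasoning

countU-++ : ∀ s t → countU (s ++ t) ≡ countU s + countU t
countU-++ [] t = refl
countU-++ (U ∷ s) t = cong suc (countU-++ s t)
countU-++ (D ∷ s) t = countU-++ s t
countU-++ (H ∷ s) t = countU-++ s t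

countD-++ : ∀ s t → countD (s ++ t) ≡ countD s + countD t
countD-++ [] t = refl
countD-++ (D ∷ s) t = cong suc (countD-++ s t)
countD-++ (U ∷ s) t = countD-++ s t
countD-++ (H ∷ s) t = countD-++ s t

wlen-++ : ∀ s t → wlen (s ++ t) ≡ wlen s + wlen t
wlen-++ [] t = refl
wlen-++ (U ∷ s) t = cong suc (wlen-++ s t)
wlen-++ (D ∷ s) t = cong suc (wlen-++ s t)
wlen-++ (H ∷ s) t = cong (λ z → suc (suc z)) (wlen-++ s t)

halfLength : Word → ℕ
halfLength w = countU w + countH w

balanced-wlen-even : ∀ w → countU w ≡ countD w → wlen w ≡ halfLength w + halfLength w
balanced-wlen-even w b = begin
  wlen w                                      ≡⟨ wlen-count w ⟩
  countU w + countD w + (countH w + countH w) ≡⟨ cong (λ d → countU w + d + (countH w + countH w)) b ⟨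
  countU w + countU w + (countH w + countH w) ≡⟨ regroup (countU w) (countH w) ⟩
  halfLength w + halfLength w                 ∎
  where
  open ≡-Reasoning
  regroup : ∀ a h → a + a + (h + h) ≡ (a + h) + (a + h)
  regroup = solve-∀

Schröder-wlen-even : ∀ {w} → Schröder w → wlen w ≡ halfLength w + halfLength w
Schröder-wlen-even {w} p = balanced-wlen-even w (Schröder-balanced p)

double-injective : ∀ i j → i + i ≡ j + j → i ≡ j
double-injective zero zero e = refl
double-injective (suc i) (suc j) e = cong suc (double-injective i j (suc-injective (begin
  suc (i + i)   ≡⟨ +-suc i i ⟨
  i + suc i     ≡⟨ suc-injective e ⟩
  j + suc j     ≡⟨ +-suc j j ⟩
  suc (j + j)   ∎)))
  where open ≡-Reasoning

UD-double : ∀ i r → suc ((i + i) + suc (r + r)) ≡ suc (i + r) + suc (i + r)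
UD-double = solve-∀

DU-double : ∀ i j r → i + i + suc (j + j + suc (r + r)) ≡ suc (i + j + r) + suc (i + j + r)
DU-double = solve-∀

wlen-DU : ∀ s1 m s2 → wlen (s1 ++ D ∷ m ++ U ∷ s2) ≡ wlen s1 + suc (wlen m + suc (wlen s2))
wlen-DU s1 m s2 rewrite wlen-++ s1 (D ∷ m ++ U ∷ s2) | wlen-++ m (U ∷ s2) = refl

UD-halfLengths : ∀ {L s1 s2} → Schröder s1 → Schröder s2 → wlen (U ∷ s1 ++ D ∷ s2) ≡ suc L + suc L →
  halfLength s1 + halfLength s2 ≡ L
UD-halfLengths {L} {s1} {s2} p1 p2 e = suc-injective (double-injective _ _ (begin
  suc (i + r) + suc (i + r)        ≡⟨ UD-double i r ⟨
  suc (i + i + suc (r + r))        ≡⟨ cong₂ (λ a b → suc (a + suc b)) (Schröder-wlen-even p1) (Schröder-wlen-even p2) ⟨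
  suc (wlen s1 + suc (wlen s2))    ≡⟨ cong suc (wlen-++ s1 (D ∷ s2)) ⟨
  wlen (U ∷ s1 ++ D ∷ s2)          ≡⟨ e ⟩
  suc L + suc L                    ∎))
  where
  open ≡-Reasoning
  i = halfLength s1
  r = halfLength s2

DU-halfLengths : ∀ {n s1 m s2} → Schröder s1 → Schröder s2 → countU m ≡ countD m → wlen (s1 ++ D ∷ m ++ U ∷ s2) ≡ n + n →
  n ≡ suc (halfLength s1 + halfLength m + halfLength s2)
DU-halfLengths {n} {s1} {m} {s2} p1 p2 bal e = sym (double-injective _ n (begin
  suc (i + j + r) + suc (i + j + r)        ≡⟨ DU-double i j r ⟨
  i + i + suc (j + j + suc (r + r))        ≡⟨ cong₂ (λ a b → a + suc b) (Schröder-wlen-even p1)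
                                                 (cong₂ (λ a b → a + suc b) (balanced-wlen-even m bal) (Schröder-wlen-even p2)) ⟨
  wlen s1 + suc (wlen m + suc (wlen s2))   ≡⟨ wlen-DU s1 m s2 ⟨
  wlen (s1 ++ D ∷ m ++ U ∷ s2)             ≡⟨ e ⟩
  n + n                                    ∎))
  where
  open ≡-Reasoning
  i = halfLength s1
  j = halfLength m
  r = halfLength s2

suc+suc-cancel : ∀ i r L → suc i + suc r ≡ suc (suc L) → i + r ≡ L
suc+suc-cancel i r L e = cong (λ x → x ∸ 2) (trans (cong suc (sym (+-suc i r))) e)

double-pred : ∀ {a b} → suc (suc a) ≡ suc b + suc b → a ≡ b + b
double-pred {a} {b} e = cong (λ x → x ∸ 2) (trans e (cong suc (+-suc b b)))

Split : Set
Split = Maybe (Word × Word)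

consSplit : Letter → Split → Split
consSplit c nothing = nothing
consSplit c (just (p , q)) = just (c ∷ p , q)

firstDescent : ℕ → Word → Split
firstDescent-D : ℕ → Word → Split
firstDescent h [] = nothing
firstDescent h (D ∷ w) = firstDescent-D h w
firstDescent h (U ∷ w) = consSplit U (firstDescent (suc h) w)
firstDescent h (H ∷ w) = consSplit H (firstDescent h w)
firstDescent-D zero w = just ([] , w)
firstDescent-D (suc h) w = consSplit D (firstDescent h w)

prependSplit : Word → Split → Split
prependSplit [] m = m
prependSplit (c ∷ s) m = consSplit c (prependSplit s m)

firstDescent-Path : ∀ {a b s} → Path a b s → ∀ r → firstDescent a (s ++ r) ≡ prependSplit s (firstDescent b r)
firstDescent-Path pnil r = refl
firstDescent-Path (pH p) r = cong (consSplit H) (firstDescent-Path p r)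
firstDescent-Path (pU p) r = cong (consSplit U) (firstDescent-Path p r)
firstDescent-Path (pD p) r = cong (consSplit D) (firstDescent-Path p r)

prependSplit-nothing : ∀ s → prependSplit s nothing ≡ nothing
prependSplit-nothing [] = refl
prependSplit-nothing (c ∷ s) rewrite prependSplit-nothing s = refl

prependSplit-just : ∀ s q → prependSplit s (just ([] , q)) ≡ just (s , q)
prependSplit-just [] q = refl
prependSplit-just (c ∷ s) q rewrite prependSplit-just s q = refl

firstDescent-Schröder : ∀ {w} → Schröder w → firstDescent 0 w ≡ nothing
firstDescent-Schröder {w} p = subst (λ z → firstDescent 0 z ≡ nothing) (++-identityʳ w) (trans (firstDescent-Path p []) (prependSplit-nothing w))

firstDescent-Schröder-D : ∀ {s} → Schröder s → ∀ r → firstDescent 0 (s ++ D ∷ r) ≡ just (s , r)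
firstDescent-Schröder-D {s} p r = trans (firstDescent-Path p (D ∷ r)) (prependSplit-just s r)

consSplit-nothing : ∀ c m → consSplit c m ≡ nothing → m ≡ nothing
consSplit-nothing c nothing _ = refl

consSplit-just : ∀ c m {p q} → consSplit c m ≡ just (p , q) → ∃[ p' ] (m ≡ just (p' , q) × p ≡ c ∷ p')
consSplit-just c (just (p' , q')) refl = p' , refl , refl

firstDescent-nothing : ∀ a w → firstDescent a w ≡ nothing → ∃[ b ] Path a b w
firstDescent-nothing a [] e = a , pnil
firstDescent-nothing zero (D ∷ w) ()
firstDescent-nothing (suc a) (D ∷ w) e with firstDescent-nothing a w (consSplit-nothing D _ e)
... | b , p = b , pD p
firstDescent-nothing a (U ∷ w) e with firstDescent-nothing (suc a) w (consSplit-nothing U _ e)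
... | b , p = b , pU p
firstDescent-nothing a (H ∷ w) e with firstDescent-nothing a w (consSplit-nothing H _ e)
... | b , p = b , pH p

firstDescent-just : ∀ a w {p q} → firstDescent a w ≡ just (p , q) → w ≡ p ++ D ∷ q × Path a 0 p
firstDescent-just a [] ()
firstDescent-just zero (D ∷ w) refl = refl , pnil
firstDescent-just (suc a) (D ∷ w) e with consSplit-just D (firstDescent a w) e
... | p' , e' , refl with firstDescent-just a w e'
...   | refl , pp = refl , pD pp
firstDescent-just a (U ∷ w) e with consSplit-just U (firstDescent (suc a) w) e
... | p' , e' , refl with firstDescent-just (suc a) w e'
...   | refl , pp = refl , pU pp
firstDescent-just a (H ∷ w) e with consSplit-just H (firstDescent a w) e
... | p' , e' , refl with firstDescent-just a w e'
...   | refl , pp = refl , pH pp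

reflectLetter : Letter → Letter
reflectLetter U = D
reflectLetter D = U
reflectLetter H = H

reflect : Word → Word
reflect [] = []
reflect (c ∷ w) = reflect w ++ reflectLetter c ∷ []

reflect-++ : ∀ s t → reflect (s ++ t) ≡ reflect t ++ reflect s
reflect-++ [] t = sym (++-identityʳ (reflect t))
reflect-++ (c ∷ s) t rewrite reflect-++ s t = ++-assoc (reflect t) (reflect s) (reflectLetter c ∷ [])

reflectLetter-involutive : ∀ c → reflectLetter (reflectLetter c) ≡ c
reflectLetter-involutive U = refl
reflectLetter-involutive D = refl
reflectLetter-involutive H = refl

reflect-involutive : ∀ w → reflect (reflect w) ≡ w
reflect-involutive [] = refl
reflect-involutive (c ∷ w) rewrite reflect-++ (reflect w) (reflectLetter c ∷ []) | reflect-involutive w | reflectLetter-involutive c = refl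

reflect-Path : ∀ {a b w} → Path a b w → Path b a (reflect w)
reflect-Path pnil = pnil
reflect-Path (pH p) = Path-++ (reflect-Path p) (pH pnil)
reflect-Path (pU p) = Path-++ (reflect-Path p) (pD pnil)
reflect-Path (pD p) = Path-++ (reflect-Path p) (pU pnil)

reflect-injective : ∀ {s t} → reflect s ≡ reflect t → s ≡ t
reflect-injective {s} {t} e = trans (sym (reflect-involutive s)) (trans (cong reflect e) (reflect-involutive t))

data BalancedView : Word → Set where
  schröder : ∀ {w} → Schröder w → BalancedView w
  dip : ∀ {s1 m s2} → Schröder s1 → Schröder s2 → BalancedView (s1 ++ D ∷ m ++ U ∷ s2)

balancedView : ∀ w → countU w ≡ countD w → BalancedView w
balancedView w bal with firstDescent 0 w in e
... | nothing with firstDescent-nothing 0 w e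
...   | b , p with Path-balanced p bal
...     | refl = schröder p
balancedView w bal | just (s1 , r) with firstDescent-just 0 w e
... | refl , p1 with firstDescent 0 (reflect r) in e2
...   | nothing with firstDescent-nothing 0 (reflect r) e2
...     | b , p = ⊥-elim (¬Path-excess-U excess (subst (Path b 0) (reflect-involutive r) (reflect-Path p)))
  where
  excess : countU r ≡ suc (countD r)
  excess = +-cancelˡ-≡ (countU s1) _ _ (begin
    countU s1 + countU r    ≡⟨ countU-++ s1 (D ∷ r) ⟨
    countU (s1 ++ D ∷ r)    ≡⟨ bal ⟩
    countD (s1 ++ D ∷ r)    ≡⟨ countD-++ s1 (D ∷ r) ⟩
    countD s1 + suc (countD r) ≡⟨ cong (_+ suc (countD r)) (Schröder-balanced p1) ⟨
    countU s1 + suc (countD r) ∎)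
    where open ≡-Reasoning
balancedView w bal | just (s1 , r) | refl , p1 | just (t1 , q) with firstDescent-just 0 (reflect r) e2
...   | e3 , p2 = subst BalancedView (cong (s1 ++_) (cong (D ∷_) (sym req))) (dip {m = reflect q} p1 (reflect-Path p2))
  where
  req : r ≡ reflect q ++ U ∷ reflect t1
  req = trans (sym (reflect-involutive r)) (trans (cong reflect e3) (trans (reflect-++ t1 (D ∷ q)) (++-assoc (reflect q) (U ∷ []) (reflect t1))))

Schröder≢Schröder-D : ∀ {w s r} → Schröder w → Schröder s → w ≢ s ++ D ∷ r
Schröder≢Schröder-D {w} {s} {r} pw ps refl = nj (trans (sym (firstDescent-Schröder pw)) (firstDescent-Schröder-D ps r))
  where
  nj : ∀ {x : Word × Word} → nothing ≢ just x
  nj ()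

Schröder-D-injective : ∀ {s t r r'} → Schröder s → Schröder t → s ++ D ∷ r ≡ t ++ D ∷ r' → s ≡ t × r ≡ r'
Schröder-D-injective {s} {t} {r} {r'} ps pt e with just-injective (trans (sym (firstDescent-Schröder-D ps r)) (trans (cong (firstDescent 0) e) (firstDescent-Schröder-D pt r')))
... | refl = refl , refl

U-Schröder-injective : ∀ {m m' s t} → Schröder s → Schröder t → m ++ U ∷ s ≡ m' ++ U ∷ t → m ≡ m' × s ≡ t
U-Schröder-injective {m} {m'} {s} {t} ps pt e with Schröder-D-injective {r = reflect m} {r' = reflect m'} (reflect-Path ps) (reflect-Path pt) eq
  where
  eq : reflect s ++ D ∷ reflect m ≡ reflect t ++ D ∷ reflect m'
  eq = trans (sym (++-assoc (reflect s) (D ∷ []) (reflect m))) (trans (sym (reflect-++ m (U ∷ s))) (trans (cong reflect e) (trans (reflect-++ m' (U ∷ t)) (++-assoc (reflect t) (D ∷ []) (reflect m')))))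
... | e1 , e2 = reflect-injective e2 , reflect-injective e1

record ValidArrows (V : List ℕ) (A : Digraph) : Set where
  field
    arrowsOnV : ∀ {a} → a ∈ A → tail a ∈ V × head a ∈ V × ¬ (tail a ≡ head a)
    noCross  : ∀ {a b} → a ∈ A → b ∈ A → ¬ Cross a b
    fwdNest  : ∀ {a b} → a ∈ A → b ∈ A → Forward a → Forward b → Nests a b ⊎ Nests b a
    noBackNestsFwd  : ∀ {a b} → a ∈ A → b ∈ A → Backward a → Forward b → ¬ Nests a b
    headNotTail  : ∀ {a b} → a ∈ A → b ∈ A → ¬ (head a ≡ tail b)
open ValidArrows public

ValidArrows-⊆ : ∀ {V W A B} → ValidArrows V A → B ⊆ A → (∀ {a} → a ∈ B → tail a ∈ W × head a ∈ W) → ValidArrows W B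
ValidArrows-⊆ vA s h = record
  { arrowsOnV = λ m → proj₁ (h m) , proj₂ (h m) , proj₂ (proj₂ (arrowsOnV vA (s m)))
  ; noCross = λ m m' → noCross vA (s m) (s m')
  ; fwdNest = λ m m' → fwdNest vA (s m) (s m')
  ; noBackNestsFwd = λ m m' → noBackNestsFwd vA (s m) (s m')
  ; headNotTail = λ m m' → headNotTail vA (s m) (s m') }

ValidArrows-≐ : ∀ {V A B} → ValidArrows V A → B ≐ A → ValidArrows V B
ValidArrows-≐ vA (f , g) = ValidArrows-⊆ vA f (λ m → proj₁ (arrowsOnV vA (f m)) , proj₁ (proj₂ (arrowsOnV vA (f m))))

ValidArrows-restrict : ∀ {V W A} → ValidArrows V A → ValidArrows W (restrict W A)
ValidArrows-restrict {V} {W} {A} vA = ValidArrows-⊆ vA (restrict-⊆ {W} {A}) (λ m → let (_ , t , h) = restrict⁻ {W} {A} m in t , h)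

ValidArrows-[] : ∀ {V} → ValidArrows V []
ValidArrows-[] = record { arrowsOnV = λ () ; noCross = λ () ; fwdNest = λ () ; noBackNestsFwd = λ () ; headNotTail = λ () }

Backwards : Digraph → Set
Backwards A = ∀ {a} → a ∈ A → Backward a

lo≤tail : ∀ a → lo a ≤ tail a
lo≤tail (p , q) = m⊓n≤m p q
lo≤head : ∀ a → lo a ≤ head a
lo≤head (p , q) = m⊓n≤n p q
tail≤hi : ∀ a → tail a ≤ hi a
tail≤hi (p , q) = m≤m⊔n p q
head≤hi : ∀ a → head a ≤ hi a
head≤hi (p , q) = m≤n⊔m p q
lo≤hi : ∀ a → lo a ≤ hi a
lo≤hi (p , q) = m⊓n≤m⊔n p q

hi-lub : ∀ a {x} → tail a ≤ x → head a ≤ x → hi a ≤ x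
hi-lub (p , q) t h = ⊔-lub t h
lo-glb : ∀ a {x} → x ≤ tail a → x ≤ head a → x ≤ lo a
lo-glb (p , q) t h = ⊓-glb t h

lo-fwd : ∀ {p q} → p < q → lo (p , q) ≡ p
lo-fwd l = m≤n⇒m⊓n≡m (<⇒≤ l)
hi-fwd : ∀ {p q} → p < q → hi (p , q) ≡ q
hi-fwd l = m≤n⇒m⊔n≡n (<⇒≤ l)
lo-bwd : ∀ {p q} → q < p → lo (p , q) ≡ q
lo-bwd l = m≥n⇒m⊓n≡n (<⇒≤ l)
hi-bwd : ∀ {p q} → q < p → hi (p , q) ≡ p
hi-bwd l = m≥n⇒m⊔n≡m (<⇒≤ l)

lo-Forward : ∀ a → Forward a → lo a ≡ tail a
lo-Forward (p , q) f = lo-fwd f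
hi-Forward : ∀ a → Forward a → hi a ≡ head a
hi-Forward (p , q) f = hi-fwd f
lo-Backward : ∀ a → Backward a → lo a ≡ head a
lo-Backward (p , q) f = lo-bwd f

Forward⇒lo<hi : ∀ a → Forward a → lo a < hi a
Forward⇒lo<hi a fa = subst₂ _<_ (sym (lo-Forward a fa)) (sym (hi-Forward a fa)) fa

hi-sel : ∀ a → hi a ≡ tail a ⊎ hi a ≡ head a
hi-sel (p , q) = ⊔-sel p q

data Orientation (a : Arrow) : Set where
  fw : Forward a → Orientation a
  bw : Backward a → Orientation a

orientation : ∀ a → ¬ (tail a ≡ head a) → Orientation a
orientation (p , q) ne with <-cmp p q
... | tri< l _ _ = fw l
... | tri≈ _ e _ = ⊥-elim (ne e)
... | tri> _ _ l = bw l

Cross-sym : ∀ {a b} → Cross a b → Cross b a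
Cross-sym (inj₁ x) = inj₂ x
Cross-sym (inj₂ y) = inj₁ y

Cross-at : ∀ a b {l h} → lo b ≡ l → hi b ≡ h → Cross a b → (lo a < l × l < hi a × hi a < h) ⊎ (l < lo a × lo a < h × h < hi a)
Cross-at a b refl refl c = c

mkCross : ∀ a b {la ha lb hb} → lo a ≡ la → hi a ≡ ha → lo b ≡ lb → hi b ≡ hb → la < lb → lb < ha → ha < hb → Cross a b
mkCross a b refl refl refl refl l1 l2 l3 = inj₁ (l1 , l2 , l3)

disjoint⇒¬Cross : ∀ a b → hi a ≤ lo b → ¬ Cross a b
disjoint⇒¬Cross a b d (inj₁ (_ , l , _)) = <-irrefl refl (<-≤-trans l d)
disjoint⇒¬Cross a b d (inj₂ (l , _ , _)) = <-irrefl refl (<-≤-trans l (≤-trans (lo≤hi a) d))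

disjoint⇒¬Cross′ : ∀ a b → hi b ≤ lo a → ¬ Cross a b
disjoint⇒¬Cross′ a b d c = disjoint⇒¬Cross b a d (Cross-sym c)

Nests⇒¬Cross : ∀ a b → Nests a b → ¬ Cross a b
Nests⇒¬Cross a b (l1 , l2) (inj₁ (_ , _ , x)) = <-irrefl refl (<-≤-trans x l2)
Nests⇒¬Cross a b (l1 , l2) (inj₂ (x , _ , _)) = <-irrefl refl (<-≤-trans x l1)

Nests⇒¬Cross′ : ∀ a b → Nests b a → ¬ Cross a b
Nests⇒¬Cross′ a b n c = Nests⇒¬Cross b a n (Cross-sym c)

disjoint⇒¬Nests : ∀ a b → lo b < hi b → hi a ≤ lo b → ¬ Nests a b
disjoint⇒¬Nests a b l d (_ , l2) = <-irrefl refl (<-≤-trans l (≤-trans l2 d))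

disjoint⇒¬Nests′ : ∀ a b → lo a < hi a → hi a ≤ lo b → ¬ Nests b a
disjoint⇒¬Nests′ a b l d (l1 , _) = <-irrefl refl (<-≤-trans l (≤-trans d l1))

Nests-refl : ∀ a → Nests a a
Nests-refl a = ≤-refl , ≤-refl

Nests-trans : ∀ {a b c} → Nests a b → Nests b c → Nests a c
Nests-trans (l1 , l2) (l3 , l4) = ≤-trans l1 l3 , ≤-trans l4 l2

Forward-Nests-antisym : ∀ {a b} → Forward a → Forward b → Nests a b → Nests b a → a ≡ b
Forward-Nests-antisym {p , q} {p' , q'} f f' (l1 , l2) (l3 , l4)
  rewrite lo-fwd f | hi-fwd f | lo-fwd f' | hi-fwd f' = cong₂ _,_ (≤-antisym l1 l3) (≤-antisym l4 l2)

nests-between : ∀ a b {x y} → lo a ≤ x → x ≤ tail b → x ≤ head b → tail b ≤ y → head b ≤ y → y ≤ hi a → Nests a b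
nests-between a b l1 l2 l3 l4 l5 l6 = ≤-trans l1 (lo-glb b l2 l3) , ≤-trans (hi-lub b l4 l5) l6

disjoint-at : ∀ a b {x} → tail a ≤ x → head a ≤ x → x ≤ tail b → x ≤ head b → hi a ≤ lo b
disjoint-at a b l1 l2 l3 l4 = ≤-trans (hi-lub a l1 l2) (lo-glb b l3 l4)

-- The map SP

onArrow : ℕ → Digraph → Bool
onArrow v A = any (λ a → ⌊ tail a ≟ v ⌋ ∨ ⌊ head a ≟ v ⌋) A

tailsInto : ℕ → Digraph → List ℕ
tailsInto v A = map tail (boolFilter (λ a → ⌊ head a ≟ v ⌋) A)

inside outside : ℕ → ℕ → List ℕ → List ℕ
inside v w V = boolFilter (λ z → ⌊ v <? z ⌋ ∧ ⌊ z ≤? w ⌋) V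
outside v w V = boolFilter (λ z → not (⌊ v <? z ⌋ ∧ ⌊ z ≤? w ⌋)) V

sp-H : ∀ k v u V A → onArrow v A ≡ false → sp (suc k) (v ∷ u ∷ V) A ≡ H ∷ sp k (u ∷ V) (restrict (u ∷ V) A)
sp-H k v u V A e rewrite e = refl

spReturn : ℕ → ℕ → ℕ → List ℕ → Digraph → Word
spReturn k v w V A = U ∷ sp k (inside v w V) (restrict (inside v w V) A) ++ D ∷ sp k (outside v w V) (restrict (outside v w V) A)

spReturn-≐ : ∀ k v w V {A B} → A ≐ B → spReturn k v w V A ≡ spReturn k v w V B

sp-U : ∀ k v u V A t ts → onArrow v A ≡ true → tailsInto v A ≡ t ∷ ts →
  sp (suc k) (v ∷ u ∷ V) A ≡ spReturn k v (minimum t ts) (v ∷ u ∷ V) A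
sp-U k v u V A t ts e e2 rewrite e | e2 = refl

sp-U-[] : ∀ k v u V A → onArrow v A ≡ true → tailsInto v A ≡ [] → sp (suc k) (v ∷ u ∷ V) A ≡ []
sp-U-[] k v u V A e e2 rewrite e | e2 = refl

onArrow-true⁻ : ∀ {v A} → onArrow v A ≡ true → ∃[ a ] (a ∈ A × (tail a ≡ v ⊎ head a ≡ v))
onArrow-true⁻ {v} {A} e with any-true⁻ _ A e
... | a , m , e' with ∨-true⁻ e'
...   | inj₁ x = a , m , inj₁ (⌊⌋-true⁻ (tail a ≟ v) x)
...   | inj₂ x = a , m , inj₂ (⌊⌋-true⁻ (head a ≟ v) x)

onArrow-false⁻ : ∀ {v A a} → onArrow v A ≡ false → a ∈ A → ¬ (tail a ≡ v) × ¬ (head a ≡ v)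
onArrow-false⁻ {v} {A} {a} e m with ∨-false⁻ (any-false⁻ (λ a → ⌊ tail a ≟ v ⌋ ∨ ⌊ head a ≟ v ⌋) e m)
... | f1 , f2 = ⌊⌋-false⁻ (tail a ≟ v) f1 , ⌊⌋-false⁻ (head a ≟ v) f2

onArrow-true⁺ : ∀ {v A a} → a ∈ A → head a ≡ v → onArrow v A ≡ true
onArrow-true⁺ {v} {A} {a} m e = any-true⁺ (λ a → ⌊ tail a ≟ v ⌋ ∨ ⌊ head a ≟ v ⌋) m (∨-trueʳ ⌊ tail a ≟ v ⌋ (⌊⌋-true (head a ≟ v) e))

tailsInto⁻ : ∀ {v A t} → t ∈ tailsInto v A → (t , v) ∈ A
tailsInto⁻ {v} {A} {t} m with ∈-map⁻ tail m
... | (p , q) , m' , refl with boolFilter⁻ (λ a → ⌊ head a ≟ v ⌋) {A} m'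
...   | m'' , e with ⌊⌋-true⁻ (q ≟ v) e
...     | refl = m''

tailsInto⁺ : ∀ {v A t} → (t , v) ∈ A → t ∈ tailsInto v A
tailsInto⁺ {v} {A} {t} m = ∈-map⁺ tail (boolFilter⁺ (λ a → ⌊ head a ≟ v ⌋) m (⌊⌋-true (v ≟ v) refl))

tailsInto-minimum : ∀ {v A t ts} → tailsInto v A ≡ t ∷ ts → (minimum t ts , v) ∈ A × (∀ {q} → (q , v) ∈ A → minimum t ts ≤ q)
tailsInto-minimum {v} {A} {t} {ts} e = tailsInto⁻ (subst (minimum t ts ∈_) (sym e) mem) , λ m → minimum-≤ t ts (subst (_ ∈_) e (tailsInto⁺ m))
  where
  mem : minimum t ts ∈ t ∷ ts
  mem with minimum-∈ t ts
  ... | inj₁ x = here x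
  ... | inj₂ y = there y

tailsInto≢[] : ∀ {v A t} → (t , v) ∈ A → tailsInto v A ≢ []
tailsInto≢[] m e with subst (_ ∈_) e (tailsInto⁺ m)
... | ()

onArrow-≐ : ∀ v {A B} → A ≐ B → onArrow v A ≡ onArrow v B
onArrow-≐ v e = any-≐ (λ a → ⌊ tail a ≟ v ⌋ ∨ ⌊ head a ≟ v ⌋) e

sp-≐ : ∀ k V A B → A ≐ B → sp k V A ≡ sp k V B
sp-≐-U : ∀ k v u V A B → A ≐ B → onArrow v A ≡ true → (la lb : List ℕ) → tailsInto v A ≡ la → tailsInto v B ≡ lb →
  sp (suc k) (v ∷ u ∷ V) A ≡ sp (suc k) (v ∷ u ∷ V) B
sp-≐ zero V A B e = refl
sp-≐ (suc k) [] A B e = refl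
sp-≐ (suc k) (v ∷ []) A B e = refl
sp-≐ (suc k) (v ∷ u ∷ V) A B e with true-or-false (onArrow v A)
... | inj₂ f = trans (sp-H k v u V A f) (trans (cong (H ∷_) (sp-≐ k (u ∷ V) _ _ (restrict-≐ (u ∷ V) e))) (sym (sp-H k v u V B (trans (sym (onArrow-≐ v e)) f))))
... | inj₁ t = sp-≐-U k v u V A B e t (tailsInto v A) (tailsInto v B) refl refl
sp-≐-U k v u V A B e t [] [] e1 e2 = trans (sp-U-[] k v u V A t e1) (sym (sp-U-[] k v u V B (trans (sym (onArrow-≐ v e)) t) e2))
sp-≐-U k v u V A B e t [] (t2 ∷ ts2) e1 e2 = ⊥-elim (tailsInto≢[] (proj₂ e (proj₁ (tailsInto-minimum e2))) e1)
sp-≐-U k v u V A B e t (t1 ∷ ts1) [] e1 e2 = ⊥-elim (tailsInto≢[] (proj₁ e (proj₁ (tailsInto-minimum e1))) e2)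
sp-≐-U k v u V A B e t (t1 ∷ ts1) (t2 ∷ ts2) e1 e2 = trans (sp-U k v u V A t1 ts1 t e1) (trans eq (sym (sp-U k v u V B t2 ts2 (trans (sym (onArrow-≐ v e)) t) e2)))
  where
  me : minimum t1 ts1 ≡ minimum t2 ts2
  me = ≤-antisym (proj₂ (tailsInto-minimum e1) (proj₂ e (proj₁ (tailsInto-minimum e2)))) (proj₂ (tailsInto-minimum e2) (proj₁ e (proj₁ (tailsInto-minimum e1))))
  eq : spReturn k v (minimum t1 ts1) (v ∷ u ∷ V) A ≡ spReturn k v (minimum t2 ts2) (v ∷ u ∷ V) B
  eq = trans (cong (λ w → spReturn k v w (v ∷ u ∷ V) A) me) (spReturn-≐ k v (minimum t2 ts2) (v ∷ u ∷ V) e)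
spReturn-≐ k v w V e = cong₂ (λ x y → U ∷ x ++ D ∷ y) (sp-≐ k _ _ _ (restrict-≐ (inside v w V) e)) (sp-≐ k _ _ _ (restrict-≐ (outside v w V) e))

inside⁺ : ∀ {v w V z} → z ∈ V → v < z → z ≤ w → z ∈ inside v w V
inside⁺ {v} {w} {V} {z} m l1 l2 = boolFilter⁺ (λ z → ⌊ v <? z ⌋ ∧ ⌊ z ≤? w ⌋) m (⌊⌋∧⌊⌋-true (v <? z) (z ≤? w) l1 l2)

inside⁻ : ∀ {v w V z} → z ∈ inside v w V → z ∈ V × v < z × z ≤ w
inside⁻ {v} {w} {V} {z} m with boolFilter⁻ (λ z → ⌊ v <? z ⌋ ∧ ⌊ z ≤? w ⌋) {V} m
... | m' , e = m' , ⌊⌋∧⌊⌋-true⁻ (v <? z) (z ≤? w) e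

outside⁺ : ∀ {v w V z} → z ∈ V → ¬ (v < z × z ≤ w) → z ∈ outside v w V
outside⁺ {v} {w} {V} {z} m h = boolFilter⁺ (λ z → not (⌊ v <? z ⌋ ∧ ⌊ z ≤? w ⌋)) m (not-true⁺ (⌊⌋∧⌊⌋-false (v <? z) (z ≤? w) h))

outside⁻ : ∀ {v w V z} → z ∈ outside v w V → z ∈ V × ¬ (v < z × z ≤ w)
outside⁻ {v} {w} {V} {z} m with boolFilter⁻ (λ z → not (⌊ v <? z ⌋ ∧ ⌊ z ≤? w ⌋)) {V} m
... | m' , e = m' , ⌊⌋∧⌊⌋-false⁻ (v <? z) (z ≤? w) (not-true⁻ e)

module SPDecompose {v : ℕ} {V' : List ℕ} {A : Digraph} {w : ℕ}
  (srt : Sorted (v ∷ V')) (vA : ValidArrows (v ∷ V') A) (bA : Backwards A)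
  (root∈ : (w , v) ∈ A) (root-minimal : ∀ {q} → (q , v) ∈ A → w ≤ q) where

  V : List ℕ
  V = v ∷ V'

  vw : v < w
  vw = bA root∈

  arrow-cases : ∀ {a} → a ∈ A → a ∈ restrict (inside v w V) A ⊎ a ∈ restrict (outside v w V) A ⊎ a ≡ (w , v)
  arrow-cases {p , q} ma with arrowsOnV vA ma | bA ma
  ... | mp , mq , ne | qp with Sorted-head srt mq
  ...   | inj₁ refl with p ≟ w
  ...     | yes refl = inj₂ (inj₂ refl)
  ...     | no p≢w = inj₂ (inj₁ (restrict⁺ ma (outside⁺ mp (λ (_ , p≤w) → p≢w (≤-antisym p≤w (root-minimal ma)))) (outside⁺ mq (λ (x , _) → <-irrefl refl x))))
  arrow-cases {p , q} ma | mp , mq , ne | qp | inj₂ vq with p ≤? w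
  ... | yes p≤w = inj₁ (restrict⁺ ma (inside⁺ mp (<-trans vq qp) p≤w) (inside⁺ mq vq (≤-trans (<⇒≤ qp) p≤w)))
  ... | no p≰w with q ≤? w
  ...   | no q≰w = inj₂ (inj₁ (restrict⁺ ma (outside⁺ mp (λ (_ , x) → p≰w x)) (outside⁺ mq (λ (_ , x) → q≰w x))))
  ...   | yes q≤w with q ≟ w
  ...     | yes refl = ⊥-elim (headNotTail vA ma root∈ refl)
  ...     | no q≢w = ⊥-elim (noCross vA root∈ ma (mkCross (w , v) (p , q) (lo-bwd vw) (hi-bwd vw) (lo-bwd qp) (hi-bwd qp) vq (≤∧≢⇒< q≤w q≢w) (≰⇒> p≰w)))

module SPCompose {v : ℕ} {V' : List ℕ} {w : ℕ} {A1 A2 : Digraph}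
  (srt : Sorted (v ∷ V')) (w∈V : w ∈ V')
  (v1 : ValidArrows (inside v w (v ∷ V')) A1) (b1 : Backwards A1)
  (v2 : ValidArrows (outside v w (v ∷ V')) A2) (b2 : Backwards A2) where

  V : List ℕ
  V = v ∷ V'

  A : Digraph
  A = (w , v) ∷ A1 ++ A2

  insideV⁻ : ∀ {z} → z ∈ inside v w V → z ∈ V × v < z × z ≤ w
  insideV⁻ = inside⁻ {v} {w} {V}
  outsideV⁻ : ∀ {z} → z ∈ outside v w V → z ∈ V × ¬ (v < z × z ≤ w)
  outsideV⁻ = outside⁻ {v} {w} {V}

  vw : v < w
  vw = proj₁ srt w∈V

  data Part (a : Arrow) : Set where
    root : a ≡ (w , v) → Part a
    inner : a ∈ A1 → Part a
    outer : a ∈ A2 → Part a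

  part : ∀ {a} → a ∈ A → Part a
  part (here e) = root e
  part (there m) with ∈-++⁻ A1 m
  ... | inj₁ x = inner x
  ... | inj₂ y = outer y

  inner-bounds : ∀ {a} → a ∈ A1 → v < head a × head a < tail a × tail a ≤ w
  inner-bounds m with arrowsOnV v1 m
  ... | mt , mh , _ = proj₁ (proj₂ (insideV⁻ mh)) , b1 m , proj₂ (proj₂ (insideV⁻ mt))

  outside-node : ∀ {z} → z ∈ outside v w V → v ≡ z ⊎ w < z
  outside-node m with outsideV⁻ m
  ... | mz , h with Sorted-head srt mz
  ...   | inj₁ e = inj₁ e
  ...   | inj₂ l = inj₂ (≰⇒> (λ x → h (l , x)))

  outer-bounds : ∀ {a} → a ∈ A2 → head a < tail a × w < tail a × (v ≡ head a ⊎ w < head a)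
  outer-bounds {a} m with arrowsOnV v2 m
  ... | mt , mh , _ with outside-node mt
  ...   | inj₂ l = b2 m , l , outside-node mh
  ...   | inj₁ e with outside-node mh
  ...     | inj₁ e' = ⊥-elim (<-irrefl (trans (sym e') e) (b2 m))
  ...     | inj₂ l' = ⊥-elim (<-asym (b2 m) (subst (_< head a) e (<-trans vw l')))

  backwards : Backwards A
  backwards m with part m
  ... | root refl = vw
  ... | inner x = b1 x
  ... | outer x = b2 x

  root-¬Cross-inner : ∀ {b} → b ∈ A1 → ¬ Cross (w , v) b
  root-¬Cross-inner {b} m = let (l1 , l2 , l3) = inner-bounds m in
    Nests⇒¬Cross (w , v) b (nests-between (w , v) b (lo≤head (w , v)) (<⇒≤ (<-trans l1 l2)) (<⇒≤ l1) l3 (<⇒≤ (<-≤-trans l2 l3)) (tail≤hi (w , v)))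

  root-¬Cross-outer : ∀ {b} → b ∈ A2 → ¬ Cross (w , v) b
  root-¬Cross-outer {b} m with outer-bounds m
  ... | l1 , l2 , inj₁ refl = Nests⇒¬Cross′ (w , v) b (nests-between b (w , v) (lo≤head b) (<⇒≤ vw) ≤-refl (<⇒≤ l2) (<⇒≤ (<-trans vw l2)) (tail≤hi b))
  ... | l1 , l2 , inj₂ l3 = disjoint⇒¬Cross (w , v) b (disjoint-at (w , v) b ≤-refl (<⇒≤ vw) (<⇒≤ l2) (<⇒≤ l3))

  inner-¬Cross-outer : ∀ {a b} → a ∈ A1 → b ∈ A2 → ¬ Cross a b
  inner-¬Cross-outer {a} {b} ma mb with inner-bounds ma | outer-bounds mb
  ... | k1 , k2 , k3 | l1 , l2 , inj₁ refl = Nests⇒¬Cross′ a b (nests-between b a (lo≤head b) (<⇒≤ (<-trans k1 k2)) (<⇒≤ k1) (≤-trans k3 (<⇒≤ l2)) (<⇒≤ (<-≤-trans k2 (≤-trans k3 (<⇒≤ l2)))) (tail≤hi b))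
  ... | k1 , k2 , k3 | l1 , l2 , inj₂ l3 = disjoint⇒¬Cross a b (disjoint-at a b k3 (<⇒≤ (<-≤-trans k2 k3)) (<⇒≤ l2) (<⇒≤ l3))

  ¬Cross-self : ∀ a → ¬ Cross a a
  ¬Cross-self a = Nests⇒¬Cross a a (Nests-refl a)

  valid : ValidArrows V A
  valid = record { arrowsOnV = ov ; noCross = nc ; fwdNest = fn ; noBackNestsFwd = bn ; headNotTail = ht }
    where
    ov : ∀ {a} → a ∈ A → tail a ∈ V × head a ∈ V × ¬ (tail a ≡ head a)
    ov m with part m
    ... | root refl = there w∈V , here refl , (λ e → <-irrefl (sym e) vw)
    ... | inner x = let (a , b , c) = arrowsOnV v1 x in proj₁ (insideV⁻ a) , proj₁ (insideV⁻ b) , c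
    ... | outer x = let (a , b , c) = arrowsOnV v2 x in proj₁ (outsideV⁻ a) , proj₁ (outsideV⁻ b) , c
    nc : ∀ {a b} → a ∈ A → b ∈ A → ¬ Cross a b
    nc ma mb with part ma | part mb
    ... | root refl | root refl = ¬Cross-self (w , v)
    ... | root refl | inner y = root-¬Cross-inner y
    ... | root refl | outer y = root-¬Cross-outer y
    ... | inner x | root refl = λ c → root-¬Cross-inner x (Cross-sym c)
    ... | inner x | inner y = noCross v1 x y
    ... | inner x | outer y = inner-¬Cross-outer x y
    ... | outer x | root refl = λ c → root-¬Cross-outer x (Cross-sym c)
    ... | outer x | inner y = λ c → inner-¬Cross-outer y x (Cross-sym c)
    ... | outer x | outer y = noCross v2 x y
    fn : ∀ {a b} → a ∈ A → b ∈ A → Forward a → Forward b → Nests a b ⊎ Nests b a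
    fn ma mb f _ = ⊥-elim (<-asym f (backwards ma))
    bn : ∀ {a b} → a ∈ A → b ∈ A → Backward a → Forward b → ¬ Nests a b
    bn ma mb _ f = ⊥-elim (<-asym f (backwards mb))
    ht : ∀ {a b} → a ∈ A → b ∈ A → ¬ (head a ≡ tail b)
    ht ma mb e with part ma | part mb
    ... | root refl | root refl = <-irrefl e vw
    ... | root refl | inner y = let (l1 , l2 , _) = inner-bounds y in <-irrefl e (<-trans l1 l2)
    ... | root refl | outer y = let (_ , l2 , _) = outer-bounds y in <-irrefl e (<-trans vw l2)
    ... | inner x | root refl = let (_ , l2 , l3) = inner-bounds x in <-irrefl e (<-≤-trans l2 l3)
    ... | inner x | inner y = headNotTail v1 x y e
    ... | inner x | outer y = let (_ , l2 , l3) = inner-bounds x in let (_ , k2 , _) = outer-bounds y in <-irrefl e (<-trans (<-≤-trans l2 l3) k2)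
    ... | outer x | root refl with outer-bounds x
    ...   | _ , _ , inj₁ e' = <-irrefl (trans e' e) vw
    ...   | _ , _ , inj₂ l = <-irrefl (sym e) l
    ht ma mb e | outer x | inner y with outer-bounds x | inner-bounds y
    ...   | _ , _ , inj₁ e' | l1 , l2 , _ = <-irrefl (trans e' e) (<-trans l1 l2)
    ...   | _ , _ , inj₂ l | l1 , l2 , l3 = <-irrefl refl (<-≤-trans l (subst (_≤ w) (sym e) l3))
    ht ma mb e | outer x | outer y = headNotTail v2 x y e

  root-minimal : ∀ {q} → (q , v) ∈ A → w ≤ q
  root-minimal m with part m
  ... | root refl = ≤-refl
  ... | inner x = let (l1 , _ , _) = inner-bounds x in ⊥-elim (<-irrefl refl l1)
  ... | outer x = let (_ , l2 , _) = outer-bounds x in <⇒≤ l2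

  restrict-inside : restrict (inside v w V) A ≐ A1
  restrict-inside = f , (λ m → let (mt , mh , _) = arrowsOnV v1 m in restrict⁺ (there (∈-++⁺ˡ m)) mt mh)
    where
    f : restrict (inside v w V) A ⊆ A1
    f m with restrict⁻ {inside v w V} {A} m
    ... | ma , mt , mh with part ma
    ...   | root refl = ⊥-elim (<-irrefl refl (proj₁ (proj₂ (insideV⁻ mh))))
    ...   | inner x = x
    ...   | outer x = let (_ , l2 , _) = outer-bounds x in ⊥-elim (<-irrefl refl (<-≤-trans l2 (proj₂ (proj₂ (insideV⁻ mt)))))

  restrict-outside : restrict (outside v w V) A ≐ A2
  restrict-outside = f , (λ m → let (mt , mh , _) = arrowsOnV v2 m in restrict⁺ (there (∈-++⁺ʳ A1 m)) mt mh)
    where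
    f : restrict (outside v w V) A ⊆ A2
    f m with restrict⁻ {outside v w V} {A} m
    ... | ma , mt , mh with part ma
    ...   | root refl = ⊥-elim (proj₂ (outsideV⁻ mt) (vw , ≤-refl))
    ...   | inner x = let (l1 , l2 , l3) = inner-bounds x in ⊥-elim (proj₂ (outsideV⁻ mt) (<-trans l1 l2 , l3))
    ...   | outer x = x

≡suc⇒≰0 : ∀ {m n} → m ≡ suc n → m ≤ 0 → ⊥
≡suc⇒≰0 refl ()

module SPUnfold {v u : ℕ} {V : List ℕ} {A : Digraph} {t : ℕ} {ts : List ℕ}
  (srt : Sorted (v ∷ u ∷ V)) (vA : ValidArrows (v ∷ u ∷ V) A) (bA : Backwards A) (e : tailsInto v A ≡ t ∷ ts) where

  VV : List ℕ
  VV = v ∷ u ∷ V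
  w : ℕ
  w = minimum t ts
  root∈ : (w , v) ∈ A
  root∈ = proj₁ (tailsInto-minimum e)
  root-minimal : ∀ {q} → (q , v) ∈ A → w ≤ q
  root-minimal = proj₂ (tailsInto-minimum e)
  vw : v < w
  vw = bA root∈
  w∈V : w ∈ u ∷ V
  w∈V with proj₁ (arrowsOnV vA root∈)
  ... | here e' = ⊥-elim (<-irrefl (sym e') vw)
  ... | there m = m
  I R : List ℕ
  I = inside v w VV
  R = outside v w VV
  length-I+R : length I + length R ≡ length VV
  length-I+R = length-boolFilter-partition (λ z → ⌊ v <? z ⌋ ∧ ⌊ z ≤? w ⌋) VV
  w∈I : w ∈ I
  w∈I = inside⁺ {v} {w} {VV} (there w∈V) vw ≤-refl
  v∈R : v ∈ R
  v∈R = outside⁺ {v} {w} {VV} (here refl) (λ (x , _) → <-irrefl refl x)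
  I<VV : length I < length VV
  I<VV = length-boolFilter< (λ z → ⌊ v <? z ⌋ ∧ ⌊ z ≤? w ⌋) VV (here refl) (⌊⌋∧⌊⌋-false (v <? v) (v ≤? w) (λ (x , _) → <-irrefl refl x))
  R<VV : length R < length VV
  R<VV = length-boolFilter< (λ z → not (⌊ v <? z ⌋ ∧ ⌊ z ≤? w ⌋)) VV (there w∈V) (not-false⁺ (⌊⌋∧⌊⌋-true (v <? w) (w ≤? w) vw ≤-refl))
  sortedI : Sorted I
  sortedI = Increasing-boolFilter (λ z → ⌊ v <? z ⌋ ∧ ⌊ z ≤? w ⌋) VV srt
  sortedR : Sorted R
  sortedR = Increasing-boolFilter (λ z → not (⌊ v <? z ⌋ ∧ ⌊ z ≤? w ⌋)) VV srt
  validI : ValidArrows I (restrict I A)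
  validI = ValidArrows-restrict {A = A} vA
  validR : ValidArrows R (restrict R A)
  validR = ValidArrows-restrict {A = A} vA
  backwardsI : Backwards (restrict I A)
  backwardsI m = bA (restrict-⊆ {I} {A} m)
  backwardsR : Backwards (restrict R A)
  backwardsR m = bA (restrict-⊆ {R} {A} m)
  lengthI : ∃[ i ] (length I ≡ suc i)
  lengthI = ∈⇒length-suc w∈I
  lengthR : ∃[ r ] (length R ≡ suc r)
  lengthR = ∈⇒length-suc v∈R
  sp-unfold : ∀ k → onArrow v A ≡ true → sp (suc k) VV A ≡ spReturn k v w VV A
  sp-unfold k o = sp-U k v u V A t ts o e

onArrow⇒tailsInto≢[] : ∀ {v u V A} → Sorted (v ∷ u ∷ V) → ValidArrows (v ∷ u ∷ V) A → Backwards A → onArrow v A ≡ true → tailsInto v A ≢ []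
onArrow⇒tailsInto≢[] {v} {u} {V} {A} srt vA bA o with onArrow-true⁻ {v} {A} o
... | (p , q) , m , inj₁ refl = ⊥-elim (<-irrefl refl (<-≤-trans (bA m) (Sorted-head≤ srt (proj₁ (proj₂ (arrowsOnV vA m))))))
... | (p , q) , m , inj₂ refl = tailsInto≢[] m

SP-Schröder : ∀ k V n A → Sorted V → length V ≡ suc n → length V ≤ k → ValidArrows V A → Backwards A → Schröder (sp k V A) × wlen (sp k V A) ≡ n + n
SP-Schröder-U : ∀ k v u V A → Sorted (v ∷ u ∷ V) → suc (suc (length V)) ≤ suc k → ValidArrows (v ∷ u ∷ V) A → Backwards A → onArrow v A ≡ true →
  ∀ la → tailsInto v A ≡ la → Schröder (sp (suc k) (v ∷ u ∷ V) A) × wlen (sp (suc k) (v ∷ u ∷ V) A) ≡ suc (length V) + suc (length V)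
SP-Schröder zero V n A s l k≤ vA bA = ⊥-elim (≡suc⇒≰0 l k≤)
SP-Schröder (suc k) (v ∷ []) zero A s refl _ vA bA = pnil , refl
SP-Schröder (suc k) (v ∷ u ∷ V) .(suc (length V)) A s refl k≤ vA bA with true-or-false (onArrow v A)
... | inj₂ f rewrite sp-H k v u V A f with SP-Schröder k (u ∷ V) (length V) (restrict (u ∷ V) A) (proj₂ s) refl (≤-pred k≤) (ValidArrows-restrict {A = A} vA) (λ m → bA (restrict-⊆ {u ∷ V} {A} m))
...   | sc , wl = pH sc , trans (cong (λ x → suc (suc x)) wl) (sym (+-suc (suc (length V)) (length V)))
SP-Schröder (suc k) (v ∷ u ∷ V) .(suc (length V)) A s refl k≤ vA bA | inj₁ o = SP-Schröder-U k v u V A s k≤ vA bA o (tailsInto v A) refl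
SP-Schröder-U k v u V A s k≤ vA bA o [] e = ⊥-elim (onArrow⇒tailsInto≢[] s vA bA o e)
SP-Schröder-U k v u V A s k≤ vA bA o (t ∷ ts) e rewrite SPUnfold.sp-unfold s vA bA e k o with SPUnfold.lengthI s vA bA e | SPUnfold.lengthR s vA bA e
... | i , li | r , lr with SP-Schröder k (SPUnfold.I s vA bA e) i _ (SPUnfold.sortedI s vA bA e) li (≤-trans (≤-pred (SPUnfold.I<VV s vA bA e)) (≤-pred k≤)) (SPUnfold.validI s vA bA e) (SPUnfold.backwardsI s vA bA e)
                      | SP-Schröder k (SPUnfold.R s vA bA e) r _ (SPUnfold.sortedR s vA bA e) lr (≤-trans (≤-pred (SPUnfold.R<VV s vA bA e)) (≤-pred k≤)) (SPUnfold.validR s vA bA e) (SPUnfold.backwardsR s vA bA e)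
...   | sc1 , wl1 | sc2 , wl2 = Schröder-UD sc1 sc2 , wl
  where
  L = length V
  s1 = sp k (SPUnfold.I s vA bA e) (restrict (SPUnfold.I s vA bA e) A)
  s2 = sp k (SPUnfold.R s vA bA e) (restrict (SPUnfold.R s vA bA e) A)
  ir : i + r ≡ L
  ir = suc+suc-cancel i r L (trans (cong₂ _+_ (sym li) (sym lr)) (SPUnfold.length-I+R s vA bA e))
  wl : suc (wlen (s1 ++ D ∷ s2)) ≡ suc L + suc L
  wl rewrite wlen-++ s1 (D ∷ s2) | wl1 | wl2 | sym ir = UD-double i r

inside-head : ∀ v w V' → Sorted (v ∷ V') → inside v w (v ∷ V') ≡ boolFilter (λ z → ⌊ z ≤? w ⌋) V'
inside-head v w V' (h , _) rewrite ⌊⌋-false (v <? v) (<-irrefl refl) =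
  boolFilter-cong _ _ V' (λ {z} m → cong (_∧ ⌊ z ≤? w ⌋) (⌊⌋-true (v <? z) (h m)))

node-with-rank : ∀ V' i → Sorted V' → i < length V' → ∃[ w ] (w ∈ V' × length (boolFilter (λ z → ⌊ z ≤? w ⌋) V') ≡ suc i)
node-with-rank (u ∷ us) zero (h , s) _ = u , here refl , eq
  where
  eq : length (boolFilter (λ z → ⌊ z ≤? u ⌋) (u ∷ us)) ≡ 1
  eq rewrite ⌊⌋-true (u ≤? u) ≤-refl | boolFilter-none (λ z → ⌊ z ≤? u ⌋) us (λ m → ⌊⌋-false (_ ≤? u) (<⇒≱ (h m))) = refl
node-with-rank (u ∷ us) (suc i) (h , s) (s≤s l) with node-with-rank us i s l
... | w , m , e = w , there m , eq
  where
  eq : length (boolFilter (λ z → ⌊ z ≤? w ⌋) (u ∷ us)) ≡ suc (suc i)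
  eq rewrite ⌊⌋-true (u ≤? w) (<⇒≤ (h m)) = cong suc e

inside-length-injective : ∀ {v V' w w'} → Sorted (v ∷ V') → w ∈ V' → w' ∈ V' → length (inside v w (v ∷ V')) ≡ length (inside v w' (v ∷ V')) → w ≡ w'
inside-length-injective {v} {V'} {w} {w'} srt m m' e with <-cmp w w'
... | tri≈ _ x _ = x
... | tri< l _ _ = ⊥-elim (<-irrefl e (length-boolFilter-strictMono _ _ (v ∷ V')
        (λ {z} _ q → let (a , b) = ⌊⌋∧⌊⌋-true⁻ (v <? z) (z ≤? w) q in ⌊⌋∧⌊⌋-true (v <? z) (z ≤? w') a (≤-trans b (<⇒≤ l)))
        (there m') (⌊⌋∧⌊⌋-false (v <? w') (w' ≤? w) (λ (_ , x) → <⇒≱ l x)) (⌊⌋∧⌊⌋-true (v <? w') (w' ≤? w') (proj₁ srt m') ≤-refl)))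
... | tri> _ _ l = ⊥-elim (<-irrefl (sym e) (length-boolFilter-strictMono _ _ (v ∷ V')
        (λ {z} _ q → let (a , b) = ⌊⌋∧⌊⌋-true⁻ (v <? z) (z ≤? w') q in ⌊⌋∧⌊⌋-true (v <? z) (z ≤? w) a (≤-trans b (<⇒≤ l)))
        (there m) (⌊⌋∧⌊⌋-false (v <? w) (w ≤? w') (λ (_ , x) → <⇒≱ l x)) (⌊⌋∧⌊⌋-true (v <? w) (w ≤? w) (proj₁ srt m) ≤-refl)))

singleton-no-arrows : ∀ {v A a} → ValidArrows (v ∷ []) A → a ∈ A → ⊥
singleton-no-arrows vA m with arrowsOnV vA m
... | here e1 , here e2 , ne = ne (trans e1 (sym e2))

offArrow⇒⊆restrict : ∀ {v u V A} → ValidArrows (v ∷ u ∷ V) A → onArrow v A ≡ false → A ⊆ restrict (u ∷ V) A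
offArrow⇒⊆restrict {v} {u} {V} {A} vA f m = let (mt , mh , _) = arrowsOnV vA m in let (n1 , n2) = onArrow-false⁻ {v} {A} f m in restrict⁺ m (∈-tail mt n1) (∈-tail mh n2)

backward-≐-by-parts : ∀ {v u V A B w} → Sorted (v ∷ u ∷ V) → ValidArrows (v ∷ u ∷ V) A → Backwards A → ValidArrows (v ∷ u ∷ V) B → Backwards B →
  (w , v) ∈ A → (∀ {q} → (q , v) ∈ A → w ≤ q) → (w , v) ∈ B → (∀ {q} → (q , v) ∈ B → w ≤ q) →
  restrict (inside v w (v ∷ u ∷ V)) A ≐ restrict (inside v w (v ∷ u ∷ V)) B →
  restrict (outside v w (v ∷ u ∷ V)) A ≐ restrict (outside v w (v ∷ u ∷ V)) B → A ≐ B
backward-≐-by-parts {v} {u} {V} {A} {B} {w} srt vA bA vB bB mA minA mB minB eI eR = f , g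
  where
  f : A ⊆ B
  f m with SPDecompose.arrow-cases srt vA bA mA minA m
  ... | inj₁ x = restrict-⊆ {inside v w (v ∷ u ∷ V)} {B} (proj₁ eI x)
  ... | inj₂ (inj₁ x) = restrict-⊆ {outside v w (v ∷ u ∷ V)} {B} (proj₁ eR x)
  ... | inj₂ (inj₂ refl) = mB
  g : B ⊆ A
  g m with SPDecompose.arrow-cases srt vB bB mB minB m
  ... | inj₁ x = restrict-⊆ {inside v w (v ∷ u ∷ V)} {A} (proj₂ eI x)
  ... | inj₂ (inj₁ x) = restrict-⊆ {outside v w (v ∷ u ∷ V)} {A} (proj₂ eR x)
  ... | inj₂ (inj₂ refl) = mA

SP-injective : ∀ k V n A B → Sorted V → length V ≡ suc n → length V ≤ k → ValidArrows V A → Backwards A → ValidArrows V B → Backwards B → sp k V A ≡ sp k V B → A ≐ B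
SP-injective-U : ∀ k v u V A B → Sorted (v ∷ u ∷ V) → suc (suc (length V)) ≤ suc k → ValidArrows (v ∷ u ∷ V) A → Backwards A → ValidArrows (v ∷ u ∷ V) B → Backwards B →
  onArrow v A ≡ true → onArrow v B ≡ true → ∀ la lb → tailsInto v A ≡ la → tailsInto v B ≡ lb → sp (suc k) (v ∷ u ∷ V) A ≡ sp (suc k) (v ∷ u ∷ V) B → A ≐ B
SP-H≢U : ∀ k v u V A B → Sorted (v ∷ u ∷ V) → ValidArrows (v ∷ u ∷ V) B → Backwards B →
  onArrow v A ≡ false → onArrow v B ≡ true → ∀ lb → tailsInto v B ≡ lb → sp (suc k) (v ∷ u ∷ V) A ≢ sp (suc k) (v ∷ u ∷ V) B
SP-injective zero V n A B s l k≤ vA bA vB bB eq = ⊥-elim (≡suc⇒≰0 l k≤)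
SP-injective (suc k) (v ∷ []) n A B s l k≤ vA bA vB bB eq = (λ m → ⊥-elim (singleton-no-arrows vA m)) , (λ m → ⊥-elim (singleton-no-arrows vB m))
SP-injective (suc k) (v ∷ u ∷ V) .(suc (length V)) A B s refl k≤ vA bA vB bB eq with true-or-false (onArrow v A) | true-or-false (onArrow v B)
... | inj₂ fa | inj₂ fb = f , g
  where
  ih : restrict (u ∷ V) A ≐ restrict (u ∷ V) B
  ih = SP-injective k (u ∷ V) (length V) _ _ (proj₂ s) refl (≤-pred k≤) (ValidArrows-restrict {A = A} vA) (λ m → bA (restrict-⊆ {u ∷ V} {A} m)) (ValidArrows-restrict {A = B} vB) (λ m → bB (restrict-⊆ {u ∷ V} {B} m))
         (proj₂ (∷-injective (trans (sym (sp-H k v u V A fa)) (trans eq (sp-H k v u V B fb)))))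
  f : A ⊆ B
  f m = restrict-⊆ {u ∷ V} {B} (proj₁ ih (offArrow⇒⊆restrict vA fa m))
  g : B ⊆ A
  g m = restrict-⊆ {u ∷ V} {A} (proj₂ ih (offArrow⇒⊆restrict vB fb m))
... | inj₂ fa | inj₁ tb = ⊥-elim (SP-H≢U k v u V A B s vB bB fa tb (tailsInto v B) refl eq)
... | inj₁ ta | inj₂ fb = ⊥-elim (SP-H≢U k v u V B A s vA bA fb ta (tailsInto v A) refl (sym eq))
... | inj₁ ta | inj₁ tb = SP-injective-U k v u V A B s k≤ vA bA vB bB ta tb (tailsInto v A) (tailsInto v B) refl refl eq
SP-H≢U k v u V A B s vB bB fa tb [] e eq = onArrow⇒tailsInto≢[] s vB bB tb e
SP-H≢U k v u V A B s vB bB fa tb (t ∷ ts) e eq with trans (sym (sp-H k v u V A fa)) (trans eq (SPUnfold.sp-unfold s vB bB e k tb))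
... | ()
SP-injective-U k v u V A B s k≤ vA bA vB bB ta tb [] lb e1 e2 eq = ⊥-elim (onArrow⇒tailsInto≢[] s vA bA ta e1)
SP-injective-U k v u V A B s k≤ vA bA vB bB ta tb (t1 ∷ ts1) [] e1 e2 eq = ⊥-elim (onArrow⇒tailsInto≢[] s vB bB tb e2)
SP-injective-U k v u V A B s k≤ vA bA vB bB ta tb (t1 ∷ ts1) (t2 ∷ ts2) e1 e2 eq = backward-≐-by-parts s vA bA vB bB (SPUnfold.root∈ s vA bA e1) (SPUnfold.root-minimal s vA bA e1) root∈B root-minimal-B eI eR
  where
  module CA = SPUnfold s vA bA e1
  module CB = SPUnfold s vB bB e2
  eq-unfolded : U ∷ sp k CA.I (restrict CA.I A) ++ D ∷ sp k CA.R (restrict CA.R A) ≡ U ∷ sp k CB.I (restrict CB.I B) ++ D ∷ sp k CB.R (restrict CB.R B)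
  eq-unfolded = trans (sym (CA.sp-unfold k ta)) (trans eq (CB.sp-unfold k tb))
  iA = proj₁ CA.lengthI
  iB = proj₁ CB.lengthI
  rA = proj₁ CA.lengthR
  SP-IA = SP-Schröder k CA.I iA (restrict CA.I A) CA.sortedI (proj₂ CA.lengthI) (≤-trans (≤-pred CA.I<VV) (≤-pred k≤)) CA.validI CA.backwardsI
  SP-IB = SP-Schröder k CB.I iB (restrict CB.I B) CB.sortedI (proj₂ CB.lengthI) (≤-trans (≤-pred CB.I<VV) (≤-pred k≤)) CB.validI CB.backwardsI
  split = Schröder-D-injective (proj₁ SP-IA) (proj₁ SP-IB) (proj₂ (∷-injective eq-unfolded))
  iAB : iA ≡ iB
  iAB = double-injective iA iB (trans (sym (proj₂ SP-IA)) (trans (cong wlen (proj₁ split)) (proj₂ SP-IB)))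
  wAB : CA.w ≡ CB.w
  wAB = inside-length-injective s CA.w∈V CB.w∈V (trans (proj₂ CA.lengthI) (trans (cong suc iAB) (sym (proj₂ CB.lengthI))))
  root∈B : (CA.w , v) ∈ B
  root∈B = subst (λ x → (x , v) ∈ B) (sym wAB) CB.root∈
  root-minimal-B : ∀ {q} → (q , v) ∈ B → CA.w ≤ q
  root-minimal-B m = subst (_≤ _) (sym wAB) (CB.root-minimal m)
  eqI : sp k CA.I (restrict CA.I A) ≡ sp k CA.I (restrict CA.I B)
  eqI = subst (λ x → sp k CA.I (restrict CA.I A) ≡ sp k (inside v x (v ∷ u ∷ V)) (restrict (inside v x (v ∷ u ∷ V)) B)) (sym wAB) (proj₁ split)
  eqR : sp k CA.R (restrict CA.R A) ≡ sp k CA.R (restrict CA.R B)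
  eqR = subst (λ x → sp k CA.R (restrict CA.R A) ≡ sp k (outside v x (v ∷ u ∷ V)) (restrict (outside v x (v ∷ u ∷ V)) B)) (sym wAB) (proj₂ split)
  validIB : ValidArrows CA.I (restrict CA.I B)
  validIB = ValidArrows-restrict {A = B} vB
  validRB : ValidArrows CA.R (restrict CA.R B)
  validRB = ValidArrows-restrict {A = B} vB
  eI : restrict CA.I A ≐ restrict CA.I B
  eI = SP-injective k CA.I iA _ _ CA.sortedI (proj₂ CA.lengthI) (≤-trans (≤-pred CA.I<VV) (≤-pred k≤)) CA.validI CA.backwardsI validIB (λ m → bB (restrict-⊆ {CA.I} {B} m)) eqI
  eR : restrict CA.R A ≐ restrict CA.R B
  eR = SP-injective k CA.R rA _ _ CA.sortedR (proj₂ CA.lengthR) (≤-trans (≤-pred CA.R<VV) (≤-pred k≤)) CA.validR CA.backwardsR validRB (λ m → bB (restrict-⊆ {CA.R} {B} m)) eqR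

SP-surjective : ∀ k V n w → Sorted V → length V ≡ suc n → length V ≤ k → Schröder w → wlen w ≡ n + n → ∃[ A ] (ValidArrows V A × Backwards A × sp k V A ≡ w)
SP-surjective zero V n w s l k≤ p e = ⊥-elim (≡suc⇒≰0 l k≤)
SP-surjective (suc k) (v ∷ []) .0 [] s refl k≤ p e = [] , ValidArrows-[] , (λ ()) , refl
SP-surjective (suc k) (v ∷ []) .0 (U ∷ w) s refl k≤ p ()
SP-surjective (suc k) (v ∷ []) .0 (D ∷ w) s refl k≤ p ()
SP-surjective (suc k) (v ∷ []) .0 (H ∷ w) s refl k≤ p ()
SP-surjective (suc k) (v ∷ u ∷ V) .(suc (length V)) w srt refl k≤ p e with schröderView p
... | vH {w'} p' with SP-surjective k (u ∷ V) (length V) w' (proj₂ srt) refl (≤-pred k≤) p' (double-pred e)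
...   | A , vA , bA , eq = A , vA-lifted , bA , trans (sp-H k v u V A v-isolated) (cong (H ∷_) (trans (sp-≐ k (u ∷ V) _ _ restrict-tail) eq))
  where
  vA-lifted : ValidArrows (v ∷ u ∷ V) A
  vA-lifted = ValidArrows-⊆ vA (λ m → m) (λ m → let (a , b , _) = arrowsOnV vA m in there a , there b)
  v-isolated : onArrow v A ≡ false
  v-isolated with true-or-false (onArrow v A)
  ... | inj₂ f = f
  ... | inj₁ t with onArrow-true⁻ {v} {A} t
  ...   | a , m , inj₁ x = ⊥-elim (<-irrefl (sym x) (proj₁ srt (proj₁ (arrowsOnV vA m))))
  ...   | a , m , inj₂ x = ⊥-elim (<-irrefl (sym x) (proj₁ srt (proj₁ (proj₂ (arrowsOnV vA m)))))
  restrict-tail : restrict (u ∷ V) A ≐ A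
  restrict-tail = restrict-⊆ {u ∷ V} {A} , λ m → let (a , b , _) = arrowsOnV vA m in restrict⁺ m a b
SP-surjective (suc k) (v ∷ u ∷ V) .(suc (length V)) .(U ∷ s1 ++ D ∷ s2) srt refl k≤ p e | vU {s1} {s2} p1 p2 = A , SPCompose.valid srt wᵥ∈V vA1 bA1 vA2 bA2 , SPCompose.backwards srt wᵥ∈V vA1 bA1 vA2 bA2 , unfolds (tailsInto v A) refl
  where
  L = length V
  VV = v ∷ u ∷ V
  i = halfLength s1
  r = halfLength s2
  halves : suc (i + r) ≡ suc L
  halves = cong suc (UD-halfLengths p1 p2 e)
  ranked = node-with-rank (u ∷ V) i (proj₂ srt) (s≤s (subst (i ≤_) (cong (λ x → x ∸ 1) halves) (m≤m+n i r)))
  wᵥ : ℕ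
  wᵥ = proj₁ ranked
  wᵥ∈V : wᵥ ∈ u ∷ V
  wᵥ∈V = proj₁ (proj₂ ranked)
  I = inside v wᵥ VV
  R = outside v wᵥ VV
  lenI : length I ≡ suc i
  lenI = trans (cong length (inside-head v wᵥ (u ∷ V) srt)) (proj₂ (proj₂ ranked))
  lenR : length R ≡ suc r
  lenR = +-cancelˡ-≡ (suc i) _ _ (trans (cong (_+ length R) (sym lenI)) (trans (length-boolFilter-partition (λ z → ⌊ v <? z ⌋ ∧ ⌊ z ≤? wᵥ ⌋) VV) (cong suc (trans (sym halves) (sym (+-suc i r))))))
  kI : length I ≤ k
  kI = ≤-trans (≤-reflexive lenI) (≤-trans (s≤s (m≤m+n i r)) (≤-trans (≤-reflexive halves) (≤-pred k≤)))
  kR : length R ≤ k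
  kR = ≤-trans (≤-reflexive lenR) (≤-trans (s≤s (m≤n+m r i)) (≤-trans (≤-reflexive halves) (≤-pred k≤)))
  sub1 = SP-surjective k I i s1 (Increasing-boolFilter (λ z → ⌊ v <? z ⌋ ∧ ⌊ z ≤? wᵥ ⌋) VV srt) lenI kI p1 (Schröder-wlen-even p1)
  sub2 = SP-surjective k R r s2 (Increasing-boolFilter (λ z → not (⌊ v <? z ⌋ ∧ ⌊ z ≤? wᵥ ⌋)) VV srt) lenR kR p2 (Schröder-wlen-even p2)
  A1 = proj₁ sub1
  A2 = proj₁ sub2
  vA1 = proj₁ (proj₂ sub1)
  bA1 = proj₁ (proj₂ (proj₂ sub1))
  vA2 = proj₁ (proj₂ sub2)
  bA2 = proj₁ (proj₂ (proj₂ sub2))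
  A : Digraph
  A = (wᵥ , v) ∷ A1 ++ A2
  v-onArrow : onArrow v A ≡ true
  v-onArrow = onArrow-true⁺ {v} {A} (here refl) refl
  unfolds : ∀ la → tailsInto v A ≡ la → sp (suc k) VV A ≡ U ∷ s1 ++ D ∷ s2
  unfolds [] e1 = ⊥-elim (tailsInto≢[] {v} {A} (here refl) e1)
  unfolds (t ∷ ts) e1 = trans (sp-U k v u V A t ts v-onArrow e1) (trans (cong (λ w → spReturn k v w VV A) me)
      (cong₂ (λ x y → U ∷ x ++ D ∷ y) (trans (sp-≐ k I _ _ (SPCompose.restrict-inside srt wᵥ∈V vA1 bA1 vA2 bA2)) (proj₂ (proj₂ (proj₂ sub1))))
                                       (trans (sp-≐ k R _ _ (SPCompose.restrict-outside srt wᵥ∈V vA1 bA1 vA2 bA2)) (proj₂ (proj₂ (proj₂ sub2))))))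
    where
    me : minimum t ts ≡ wᵥ
    me = ≤-antisym (proj₂ (tailsInto-minimum {v} {A} e1) (here refl)) (SPCompose.root-minimal srt wᵥ∈V vA1 bA1 vA2 bA2 (proj₁ (tailsInto-minimum {v} {A} e1)))

-- Twisting

twistPred : ℕ → ℕ → Arrow → Bool
twistPred x y a = ⌊ tail a ≟ x ⌋ ∧ not ⌊ head a ≟ y ⌋

data TwistMember (x y : ℕ) (M : List ℕ) (B : Digraph) (c : Arrow) : Set where
  kept : c ∈ B → tail c ∈ twistNodes x M → head c ∈ twistNodes x M → TwistMember x y M B c
  moved : ∀ z → c ≡ (y , z) → (x , z) ∈ B → z ≢ y → TwistMember x y M B c

twist⁻ : ∀ x y M B {c} → c ∈ twist x y M B → TwistMember x y M B c
twist⁻ x y M B {c} m with ∈-++⁻ (restrict (twistNodes x M) B) m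
... | inj₁ m1 = let (a , b , d) = restrict⁻ {twistNodes x M} {B} m1 in kept a b d
... | inj₂ m2 with ∈-map⁻ (λ a → (y , head a)) m2
...   | (p , q) , m3 , refl with boolFilter⁻ (twistPred x y) {B} m3
...     | m4 , e with ⌊⌋-true⁻ (p ≟ x) (proj₁ (∧-true⁻ e))
...       | refl = moved q refl m4 (⌊⌋-false⁻ (q ≟ y) (not-true⁻ (proj₂ (∧-true⁻ e))))

twist⁺-kept : ∀ x y M B {c} → c ∈ B → tail c ∈ twistNodes x M → head c ∈ twistNodes x M → c ∈ twist x y M B
twist⁺-kept x y M B m a b = ∈-++⁺ˡ (restrict⁺ m a b)

twist⁺-moved : ∀ x y M B {z} → (x , z) ∈ B → z ≢ y → (y , z) ∈ twist x y M B
twist⁺-moved x y M B {z} m ne = ∈-++⁺ʳ (restrict (twistNodes x M) B) (∈-map⁺ (λ a → (y , head a)) (boolFilter⁺ (twistPred x y) m (∧-true⁺ (⌊⌋-true (x ≟ x) refl) (not-true⁺ (⌊⌋-false (z ≟ y) ne)))))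

twist-≐ : ∀ x y M {B B'} → B ≐ B' → twist x y M B ≐ twist x y M B'
twist-≐ x y M {B} {B'} (f , g) = h f , h g
  where
  h : ∀ {P Q} → P ⊆ Q → twist x y M P ⊆ twist x y M Q
  h {P} {Q} s m with twist⁻ x y M P m
  ... | kept a b d = twist⁺-kept x y M Q (s a) b d
  ... | moved z refl b d = twist⁺-moved x y M Q (s b) d

module Twist {x y : ℕ} {M : List ℕ} (xy : x < y) (bnd : ∀ {z} → z ∈ M → x ≤ z × z ≤ y) where

  M' : List ℕ
  M' = twistNodes x M

  twistNodes⁺ : ∀ {z} → z ∈ M → x < z → z ∈ M'
  twistNodes⁺ {z} m l = boolFilter⁺ (λ z → ⌊ x <? z ⌋) m (⌊⌋-true (x <? z) l)

  twistNodes⁻ : ∀ {z} → z ∈ M' → z ∈ M × x < z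
  twistNodes⁻ {z} m with boolFilter⁻ (λ z → ⌊ x <? z ⌋) {M} m
  ... | m' , e = m' , ⌊⌋-true⁻ (x <? z) e

  twistNodes-bounds : ∀ {z} → z ∈ M' → x < z × z ≤ y
  twistNodes-bounds m = let (a , b) = twistNodes⁻ m in b , proj₂ (bnd a)

  module Forth {B : Digraph} (vB : ValidArrows M B) (mxy : (x , y) ∈ B) where
    C : Digraph
    C = twist x y M B

    moved-bounds : ∀ {z} → (x , z) ∈ B → z ≢ y → x < z × z < y
    moved-bounds {z} m ne = let (_ , mz , nxz) = arrowsOnV vB m in let (l1 , l2) = bnd mz in ≤∧≢⇒< l1 nxz , ≤∧≢⇒< l2 ne

    kept-bounds : ∀ {c} → tail c ∈ M' → head c ∈ M' → x < lo c × hi c ≤ y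
    kept-bounds {c} a b = lo-glb c (proj₁ (twistNodes-bounds a)) (proj₁ (twistNodes-bounds b)) , hi-lub c (proj₂ (twistNodes-bounds a)) (proj₂ (twistNodes-bounds b))

    kept-¬Cross-moved : ∀ {a z} → a ∈ B → tail a ∈ M' → head a ∈ M' → (x , z) ∈ B → z ≢ y → ¬ Cross a (y , z)
    kept-¬Cross-moved {a} {z} ma ta ha mz ne c with moved-bounds mz ne | kept-bounds {a} ta ha
    ... | xz , zy | xa , ay with Cross-at a (y , z) (lo-bwd zy) (hi-bwd zy) c
    ...   | inj₁ (l1 , l2 , l3) = noCross vB mz ma (mkCross (x , z) a (lo-fwd xz) (hi-fwd xz) refl refl xa l1 l2)
    ...   | inj₂ (_ , _ , l3) = <-irrefl refl (<-≤-trans l3 ay)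

    moved-¬Cross-moved : ∀ {z z'} → z < y → z' < y → ¬ Cross (y , z) (y , z')
    moved-¬Cross-moved {z} {z'} zy zy' c with Cross-at (y , z) (y , z') (lo-bwd zy') (hi-bwd zy') c
    ... | inj₁ (_ , _ , l) = <-irrefl refl (subst (_< y) (hi-bwd zy) l)
    ... | inj₂ (_ , _ , l) = <-irrefl refl (subst (y <_) (hi-bwd zy) l)

    valid : ValidArrows M' C
    valid = record { arrowsOnV = ov ; noCross = nc ; fwdNest = fn ; noBackNestsFwd = bn ; headNotTail = ht }
      where
      ov : ∀ {c} → c ∈ C → tail c ∈ M' × head c ∈ M' × ¬ (tail c ≡ head c)
      ov m with twist⁻ x y M B m
      ... | kept a b d = b , d , proj₂ (proj₂ (arrowsOnV vB a))
      ... | moved z refl b d = twistNodes⁺ (proj₁ (proj₂ (arrowsOnV vB mxy))) xy , twistNodes⁺ (proj₁ (proj₂ (arrowsOnV vB b))) (proj₁ (moved-bounds b d)) , (λ e → d (sym e))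
      nc : ∀ {a b} → a ∈ C → b ∈ C → ¬ Cross a b
      nc ma mb with twist⁻ x y M B ma | twist⁻ x y M B mb
      ... | kept a1 a2 a3 | kept b1 b2 b3 = noCross vB a1 b1
      ... | kept a1 a2 a3 | moved z refl b2 b3 = kept-¬Cross-moved a1 a2 a3 b2 b3
      ... | moved z refl a2 a3 | kept b1 b2 b3 = λ c → kept-¬Cross-moved b1 b2 b3 a2 a3 (Cross-sym c)
      ... | moved z refl a2 a3 | moved z' refl b2 b3 = moved-¬Cross-moved (proj₂ (moved-bounds a2 a3)) (proj₂ (moved-bounds b2 b3))
      fn : ∀ {a b} → a ∈ C → b ∈ C → Forward a → Forward b → Nests a b ⊎ Nests b a
      fn ma mb fa fb with twist⁻ x y M B ma | twist⁻ x y M B mb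
      ... | kept a1 _ _ | kept b1 _ _ = fwdNest vB a1 b1 fa fb
      ... | moved z refl a2 a3 | _ = ⊥-elim (<-asym fa (proj₂ (moved-bounds a2 a3)))
      ... | kept _ _ _ | moved z refl b2 b3 = ⊥-elim (<-asym fb (proj₂ (moved-bounds b2 b3)))
      bn : ∀ {a b} → a ∈ C → b ∈ C → Backward a → Forward b → ¬ Nests a b
      bn {a} {b} ma mb ba fb with twist⁻ x y M B ma | twist⁻ x y M B mb
      ... | kept a1 _ _ | kept b1 _ _ = noBackNestsFwd vB a1 b1 ba fb
      ... | _ | moved z refl b2 b3 = ⊥-elim (<-asym fb (proj₂ (moved-bounds b2 b3)))
      ... | moved z refl a2 a3 | kept b1 b2 b3 = λ (l1 , l2) → help (subst (_≤ lo b) (lo-bwd (proj₂ (moved-bounds a2 a3))) l1)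
        where
        help : z ≤ lo b → ⊥
        xz = proj₁ (moved-bounds a2 a3)
        help zl with fwdNest vB a2 b1 xz fb
        ... | inj₁ (_ , k2) = <-irrefl refl (≤-<-trans zl (<-≤-trans (Forward⇒lo<hi b fb) (≤-trans k2 (≤-reflexive (hi-fwd xz)))))
        ... | inj₂ (k1 , _) = <-irrefl refl (<-≤-trans (proj₁ (kept-bounds {b} b2 b3)) (≤-trans k1 (≤-reflexive (lo-fwd xz))))
      ht : ∀ {a b} → a ∈ C → b ∈ C → ¬ (head a ≡ tail b)
      ht {a} {b} ma mb e with twist⁻ x y M B ma | twist⁻ x y M B mb
      ... | kept a1 _ _ | kept b1 _ _ = headNotTail vB a1 b1 e
      ... | moved z refl a2 a3 | kept b1 _ _ = headNotTail vB a2 b1 e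
      ... | moved z refl a2 a3 | moved z' refl _ _ = <-irrefl e (proj₂ (moved-bounds a2 a3))
      ... | kept a1 a2 a3 | moved z refl b2 b3 = help
        where
        ta : x < tail a × tail a ≤ y
        ta = twistNodes-bounds a2
        fa : Forward a
        fa = subst (tail a <_) (sym e) (≤∧≢⇒< (proj₂ ta) (λ e' → proj₂ (proj₂ (arrowsOnV vB a1)) (trans e' (sym e))))
        xz = proj₁ (moved-bounds b2 b3)
        help : ⊥
        help with fwdNest vB b2 a1 xz fa
        ... | inj₁ (_ , k2) = <-irrefl refl (<-≤-trans (proj₂ (moved-bounds b2 b3)) (≤-trans (≤-reflexive (trans (sym e) (sym (hi-Forward a fa)))) (≤-trans k2 (≤-reflexive (hi-fwd xz)))))
        ... | inj₂ (k1 , _) = <-irrefl refl (<-≤-trans (proj₁ ta) (≤-trans (≤-reflexive (sym (lo-Forward a fa))) (≤-trans k1 (≤-reflexive (lo-fwd xz)))))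

untwist : ℕ → ℕ → Digraph → Digraph
untwist x y C = (x , y) ∷ boolFilter (λ a → not ⌊ tail a ≟ y ⌋) C ++ map (λ a → (x , head a)) (boolFilter (λ a → ⌊ tail a ≟ y ⌋) C)

data UntwistMember (x y : ℕ) (C : Digraph) (c : Arrow) : Set where
  root : c ≡ (x , y) → UntwistMember x y C c
  kept : c ∈ C → tail c ≢ y → UntwistMember x y C c
  moved : ∀ z → c ≡ (x , z) → (y , z) ∈ C → UntwistMember x y C c

untwist⁻ : ∀ x y C {c} → c ∈ untwist x y C → UntwistMember x y C c
untwist⁻ x y C (here e) = root e
untwist⁻ x y C {c} (there m) with ∈-++⁻ (boolFilter (λ a → not ⌊ tail a ≟ y ⌋) C) m
... | inj₁ m1 = let (a , e) = boolFilter⁻ (λ a → not ⌊ tail a ≟ y ⌋) {C} m1 in kept a (⌊⌋-false⁻ (tail c ≟ y) (not-true⁻ e))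
... | inj₂ m2 with ∈-map⁻ (λ a → (x , head a)) m2
...   | (p , q) , m3 , refl with boolFilter⁻ (λ a → ⌊ tail a ≟ y ⌋) {C} m3
...     | m4 , e with ⌊⌋-true⁻ (p ≟ y) e
...       | refl = moved q refl m4

untwist⁺-kept : ∀ x y C {c} → c ∈ C → tail c ≢ y → c ∈ untwist x y C
untwist⁺-kept x y C {c} m ne = there (∈-++⁺ˡ (boolFilter⁺ (λ a → not ⌊ tail a ≟ y ⌋) m (not-true⁺ (⌊⌋-false (tail c ≟ y) ne))))

untwist⁺-moved : ∀ x y C {z} → (y , z) ∈ C → (x , z) ∈ untwist x y C
untwist⁺-moved x y C m = there (∈-++⁺ʳ (boolFilter (λ a → not ⌊ tail a ≟ y ⌋) C) (∈-map⁺ (λ a → (x , head a)) (boolFilter⁺ (λ a → ⌊ tail a ≟ y ⌋) m (⌊⌋-true (y ≟ y) refl))))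

module Untwist {x y : ℕ} {M : List ℕ} (xy : x < y) (bnd : ∀ {z} → z ∈ M → x ≤ z × z ≤ y) (x∈M : x ∈ M) (y∈M : y ∈ M) where
  open Twist xy bnd

  twist-reflects-⊆ : ∀ {B1 B2} → ValidArrows M B1 → (x , y) ∈ B1 → ValidArrows M B2 → (x , y) ∈ B2 → twist x y M B1 ≐ twist x y M B2 → B1 ⊆ B2
  twist-reflects-⊆ {B1} {B2} v1 m1 v2 m2 e {p , q} m with p ≟ x
  ... | yes refl with q ≟ y
  ...   | yes refl = m2
  ...   | no ne with twist⁻ x y M B2 (proj₁ e (twist⁺-moved x y M B1 m ne))
  ...     | kept m' _ _ = ⊥-elim (headNotTail v2 m2 m' refl)
  ...     | moved z eq m' _ with ,-injective eq
  ...       | _ , refl = m'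
  twist-reflects-⊆ {B1} {B2} v1 m1 v2 m2 e {p , q} m | no p≢x with arrowsOnV v1 m
  ... | pM , qM , _ with twist⁻ x y M B2 (proj₁ e (twist⁺-kept x y M B1 m (twistNodes⁺ pM (≤∧≢⇒< (proj₁ (bnd pM)) (λ e' → p≢x (sym e')))) (twistNodes⁺ qM (≤∧≢⇒< (proj₁ (bnd qM)) (λ e' → headNotTail v1 m m1 (sym e'))))))
  ...   | kept m' _ _ = m'
  ...   | moved z eq _ _ = ⊥-elim (headNotTail v1 m1 m (sym (proj₁ (,-injective eq))))

  module Back {C : Digraph} (vC : ValidArrows M' C) where
    Bu : Digraph
    Bu = untwist x y C

    bounds : ∀ {c} → c ∈ C → (x < tail c × tail c ≤ y) × (x < head c × head c ≤ y)
    bounds m = let (a , b , _) = arrowsOnV vC m in twistNodes-bounds a , twistNodes-bounds b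

    untwisted-bounds : ∀ {z} → (y , z) ∈ C → x < z × z < y
    untwisted-bounds m = let ((_ , _) , (l1 , l2)) = bounds m in l1 , ≤∧≢⇒< l2 (λ e → proj₂ (proj₂ (arrowsOnV vC m)) (sym e))

    endpoint-bounds : ∀ {c} → c ∈ Bu → (x ≤ tail c × tail c ≤ y) × (x ≤ head c × head c ≤ y)
    endpoint-bounds m with untwist⁻ x y C m
    ... | root refl = (≤-refl , <⇒≤ xy) , (<⇒≤ xy , ≤-refl)
    ... | kept m' _ = let ((a , b) , (c , d)) = bounds m' in (<⇒≤ a , b) , (<⇒≤ c , d)
    ... | moved z refl m' = let (a , b) = untwisted-bounds m' in (≤-refl , <⇒≤ xy) , (<⇒≤ a , <⇒≤ b)

    x<head : ∀ {c} → c ∈ Bu → x < head c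
    x<head m with untwist⁻ x y C m
    ... | root refl = xy
    ... | kept m' _ = proj₁ (proj₂ (bounds m'))
    ... | moved z refl m' = proj₁ (untwisted-bounds m')

    root-nests : ∀ {b} → b ∈ Bu → Nests (x , y) b
    root-nests {b} m = let ((a1 , a2) , (a3 , a4)) = endpoint-bounds m in nests-between (x , y) b (lo≤tail (x , y)) a1 a3 a2 a4 (head≤hi (x , y))

    x<lo : ∀ {a} → a ∈ C → x < lo a
    x<lo {a} m = let ((a1 , _) , (a3 , _)) = bounds m in lo-glb a a1 a3
    hi≤y : ∀ {a} → a ∈ C → hi a ≤ y
    hi≤y {a} m = let ((_ , a2) , (_ , a4)) = bounds m in hi-lub a a2 a4

    ¬straddles : ∀ {a z} → a ∈ C → tail a ≢ y → (y , z) ∈ C → lo a < z → z < hi a → ⊥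
    ¬straddles {a} {z} m ne mz l1 l2 with m≤n⇒m<n∨m≡n (hi≤y m)
    ... | inj₁ l3 = noCross vC m mz (mkCross a (y , z) refl refl (lo-bwd (proj₂ (untwisted-bounds mz))) (hi-bwd (proj₂ (untwisted-bounds mz))) l1 l2 l3)
    ... | inj₂ e with hi-sel a
    ...   | inj₁ e' = ne (trans (sym e') e)
    ...   | inj₂ e' = headNotTail vC m mz (trans (sym e') e)

    kept-¬Cross-moved : ∀ {a z} → a ∈ C → tail a ≢ y → (y , z) ∈ C → ¬ Cross a (x , z)
    kept-¬Cross-moved {a} {z} m ne mz c with Cross-at a (x , z) (lo-fwd (proj₁ (untwisted-bounds mz))) (hi-fwd (proj₁ (untwisted-bounds mz))) c
    ... | inj₁ (l1 , _ , _) = <-asym l1 (x<lo m)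
    ... | inj₂ (_ , l2 , l3) = ¬straddles m ne mz l2 l3

    untwisted-nests-kept : ∀ {a z} → a ∈ C → tail a ≢ y → (y , z) ∈ C → Forward a → Nests (x , z) a
    untwisted-nests-kept {a} {z} m ne mz fa with z ≤? lo a
    ... | yes zl = ⊥-elim (noBackNestsFwd vC mz m (proj₂ (untwisted-bounds mz)) fa (≤-trans (≤-reflexive (lo-bwd (proj₂ (untwisted-bounds mz)))) zl , ≤-trans (hi≤y m) (≤-reflexive (sym (hi-bwd (proj₂ (untwisted-bounds mz)))))))
    ... | no zl with hi a ≤? z
    ...   | yes hz = ≤-trans (≤-reflexive (lo-fwd (proj₁ (untwisted-bounds mz)))) (<⇒≤ (x<lo m)) , ≤-trans hz (≤-reflexive (sym (hi-fwd (proj₁ (untwisted-bounds mz)))))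
    ...   | no hz = ⊥-elim (¬straddles m ne mz (≰⇒> zl) (≰⇒> hz))

    valid : ValidArrows M Bu
    valid = record { arrowsOnV = ov ; noCross = nc ; fwdNest = fn ; noBackNestsFwd = bn ; headNotTail = ht }
      where
      ov : ∀ {c} → c ∈ Bu → tail c ∈ M × head c ∈ M × ¬ (tail c ≡ head c)
      ov m with untwist⁻ x y C m
      ... | root refl = x∈M , y∈M , (λ e → <-irrefl e xy)
      ... | kept m' _ = let (a , b , c) = arrowsOnV vC m' in proj₁ (twistNodes⁻ a) , proj₁ (twistNodes⁻ b) , c
      ... | moved z refl m' = x∈M , proj₁ (twistNodes⁻ (proj₁ (proj₂ (arrowsOnV vC m')))) , (λ e → <-irrefl e (proj₁ (untwisted-bounds m')))
      nc : ∀ {a b} → a ∈ Bu → b ∈ Bu → ¬ Cross a b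
      nc {a} {b} ma mb with untwist⁻ x y C ma | untwist⁻ x y C mb
      ... | root refl | _ = Nests⇒¬Cross (x , y) b (root-nests mb)
      ... | kept _ _ | root refl = Nests⇒¬Cross′ a (x , y) (root-nests ma)
      ... | moved _ _ _ | root refl = Nests⇒¬Cross′ a (x , y) (root-nests ma)
      ... | kept a1 a2 | kept b1 b2 = noCross vC a1 b1
      ... | kept a1 a2 | moved z refl b2 = kept-¬Cross-moved a1 a2 b2
      ... | moved z refl a2 | kept b1 b2 = λ c → kept-¬Cross-moved b1 b2 a2 (Cross-sym c)
      ... | moved z refl a2 | moved z' refl b2 = λ c → help (Cross-at (x , z) (x , z') (lo-fwd (proj₁ (untwisted-bounds b2))) (hi-fwd (proj₁ (untwisted-bounds b2))) c)
        where
        help : _ → ⊥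
        help (inj₁ (l , _ , _)) = <-irrefl (lo-fwd (proj₁ (untwisted-bounds a2))) l
        help (inj₂ (l , _ , _)) = <-irrefl (sym (lo-fwd (proj₁ (untwisted-bounds a2)))) l
      fn : ∀ {a b} → a ∈ Bu → b ∈ Bu → Forward a → Forward b → Nests a b ⊎ Nests b a
      fn {a} {b} ma mb fa fb with untwist⁻ x y C ma | untwist⁻ x y C mb
      ... | root refl | _ = inj₁ (root-nests mb)
      ... | kept _ _ | root refl = inj₂ (root-nests ma)
      ... | moved _ _ _ | root refl = inj₂ (root-nests ma)
      ... | kept a1 a2 | kept b1 b2 = fwdNest vC a1 b1 fa fb
      ... | kept a1 a2 | moved z refl b2 = inj₂ (untwisted-nests-kept a1 a2 b2 fa)
      ... | moved z refl a2 | kept b1 b2 = inj₁ (untwisted-nests-kept b1 b2 a2 fb)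
      ... | moved z refl a2 | moved z' refl b2 with ≤-total z z'
      ...   | inj₁ l = inj₂ (≤-reflexive (trans (lo-fwd (proj₁ (untwisted-bounds b2))) (sym (lo-fwd (proj₁ (untwisted-bounds a2))))) , ≤-trans (≤-reflexive (hi-fwd (proj₁ (untwisted-bounds a2)))) (≤-trans l (≤-reflexive (sym (hi-fwd (proj₁ (untwisted-bounds b2)))))))
      ...   | inj₂ l = inj₁ (≤-reflexive (trans (lo-fwd (proj₁ (untwisted-bounds a2))) (sym (lo-fwd (proj₁ (untwisted-bounds b2))))) , ≤-trans (≤-reflexive (hi-fwd (proj₁ (untwisted-bounds b2)))) (≤-trans l (≤-reflexive (sym (hi-fwd (proj₁ (untwisted-bounds a2)))))))
      bn : ∀ {a b} → a ∈ Bu → b ∈ Bu → Backward a → Forward b → ¬ Nests a b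
      bn {a} {b} ma mb ba fb with untwist⁻ x y C ma
      ... | root refl = ⊥-elim (<-asym ba xy)
      ... | moved z refl a2 = ⊥-elim (<-asym ba (proj₁ (untwisted-bounds a2)))
      ... | kept a1 a2 with untwist⁻ x y C mb
      ...   | root refl = λ (l , _) → <-irrefl refl (<-≤-trans (x<lo a1) (≤-trans l (≤-reflexive (lo-fwd xy))))
      ...   | kept b1 b2 = noBackNestsFwd vC a1 b1 ba fb
      ...   | moved z refl b2 = λ (l , _) → <-irrefl refl (<-≤-trans (x<lo a1) (≤-trans l (≤-reflexive (lo-fwd (proj₁ (untwisted-bounds b2))))))
      ht : ∀ {a b} → a ∈ Bu → b ∈ Bu → ¬ (head a ≡ tail b)
      ht {a} {b} ma mb e with untwist⁻ x y C mb
      ... | root refl = <-irrefl (sym e) (x<head ma)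
      ... | moved z refl _ = <-irrefl (sym e) (x<head ma)
      ... | kept b1 b2 with untwist⁻ x y C ma
      ...   | root refl = b2 (sym e)
      ...   | kept a1 _ = headNotTail vC a1 b1 e
      ...   | moved z refl a2 = headNotTail vC a2 b1 e

    root∈ : (x , y) ∈ Bu
    root∈ = here refl

    twist-untwist : twist x y M Bu ≐ C
    twist-untwist = f , g
      where
      f : twist x y M Bu ⊆ C
      f m with twist⁻ x y M Bu m
      ... | kept m' tM hM with untwist⁻ x y C m'
      ...   | root refl = ⊥-elim (<-irrefl refl (proj₂ (twistNodes⁻ tM)))
      ...   | kept c _ = c
      ...   | moved z refl _ = ⊥-elim (<-irrefl refl (proj₂ (twistNodes⁻ tM)))
      f m | moved z refl m' ne with untwist⁻ x y C m'
      ...   | root e = ⊥-elim (ne (proj₂ (,-injective e)))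
      ...   | kept c _ = ⊥-elim (<-irrefl refl (proj₂ (twistNodes⁻ (proj₁ (arrowsOnV vC c)))))
      ...   | moved z' e c with ,-injective e
      ...     | _ , refl = c
      g : C ⊆ twist x y M Bu
      g {p , q} m with p ≟ y
      ... | yes refl = twist⁺-moved x y M Bu (untwist⁺-moved x y C m) (λ e → proj₂ (proj₂ (arrowsOnV vC m)) (sym e))
      ... | no ne = let (a , b , _) = arrowsOnV vC m in twist⁺-kept x y M Bu (untwist⁺-kept x y C m ne) a b

-- The map DP

outermost-nests : ∀ c cs → (∀ {a b} → a ∈ c ∷ cs → b ∈ c ∷ cs → Nests a b ⊎ Nests b a) →
  outermost c cs ∈ c ∷ cs × (∀ {b} → b ∈ c ∷ cs → Nests (outermost c cs) b)
outermost-nests c [] cmp = here refl , λ { (here refl) → Nests-refl c }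
outermost-nests c (a ∷ as) cmp with true-or-false (nestsB a c)
... | inj₁ t rewrite t with outermost-nests a as (λ ma mb → cmp (there ma) (there mb))
...   | m , n = there m , λ { (here refl) → Nests-trans (n (here refl)) (⌊⌋∧⌊⌋-true⁻ (lo a ≤? lo c) (hi c ≤? hi a) t) ; (there mb) → n mb }
outermost-nests c (a ∷ as) cmp | inj₂ f rewrite f with outermost-nests c as (λ ma mb → cmp (∈-skipSecond ma) (∈-skipSecond mb))
...   | m , n = ∈-skipSecond m , λ { (here refl) → n (here refl) ; (there (here refl)) → Nests-trans (n (here refl)) c-nests-a ; (there (there mb)) → n (there mb) }
  where
  c-nests-a : Nests c a
  c-nests-a with cmp (here refl) (there (here refl))
  ... | inj₁ x = x
  ... | inj₂ y = ⊥-elim (⌊⌋∧⌊⌋-false⁻ (lo a ≤? lo c) (hi c ≤? hi a) f y)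

forwards⁻ : ∀ {A b} → b ∈ forwards A → b ∈ A × Forward b
forwards⁻ {A} {b} m = let (m' , e) = boolFilter⁻ (λ a → ⌊ tail a <? head a ⌋) {A} m in m' , ⌊⌋-true⁻ (tail b <? head b) e

forwards⁺ : ∀ {A b} → b ∈ A → Forward b → b ∈ forwards A
forwards⁺ {A} {b} m f = boolFilter⁺ (λ a → ⌊ tail a <? head a ⌋) m (⌊⌋-true (tail b <? head b) f)

outermost-spec : ∀ {V A f fs} → ValidArrows V A → forwards A ≡ f ∷ fs →
  outermost f fs ∈ A × Forward (outermost f fs) × (∀ {b} → b ∈ A → Forward b → Nests (outermost f fs) b)
outermost-spec {V} {A} {f} {fs} vA e with outermost-nests f fs (λ ma mb → let (a1 , a2) = forwards⁻ {A} (subst (_ ∈_) (sym e) ma) in let (b1 , b2) = forwards⁻ {A} (subst (_ ∈_) (sym e) mb) in fwdNest vA a1 b1 a2 b2)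
... | m , n = proj₁ (forwards⁻ {A} (subst (_ ∈_) (sym e) m)) , proj₂ (forwards⁻ {A} (subst (_ ∈_) (sym e) m)) , λ mb fb → n (subst (_ ∈_) e (forwards⁺ mb fb))

atMost atLeast : ℕ → List ℕ → List ℕ
atMost x V = boolFilter (λ z → ⌊ z ≤? x ⌋) V
atLeast y V = boolFilter (λ z → ⌊ y ≤? z ⌋) V

atMost⁺ : ∀ {x V z} → z ∈ V → z ≤ x → z ∈ atMost x V
atMost⁺ {x} {V} {z} m l = boolFilter⁺ (λ z → ⌊ z ≤? x ⌋) m (⌊⌋-true (z ≤? x) l)
atMost⁻ : ∀ {x V z} → z ∈ atMost x V → z ∈ V × z ≤ x
atMost⁻ {x} {V} {z} m = let (m' , e) = boolFilter⁻ (λ z → ⌊ z ≤? x ⌋) {V} m in m' , ⌊⌋-true⁻ (z ≤? x) e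
atLeast⁺ : ∀ {y V z} → z ∈ V → y ≤ z → z ∈ atLeast y V
atLeast⁺ {y} {V} {z} m l = boolFilter⁺ (λ z → ⌊ y ≤? z ⌋) m (⌊⌋-true (y ≤? z) l)
atLeast⁻ : ∀ {y V z} → z ∈ atLeast y V → z ∈ V × y ≤ z
atLeast⁻ {y} {V} {z} m = let (m' , e) = boolFilter⁻ (λ z → ⌊ y ≤? z ⌋) {V} m in m' , ⌊⌋-true⁻ (y ≤? z) e
between⁺ : ∀ {x y V z} → z ∈ V → x ≤ z → z ≤ y → z ∈ between x y V
between⁺ {x} {y} {V} {z} m l1 l2 = boolFilter⁺ (λ z → ⌊ x ≤? z ⌋ ∧ ⌊ z ≤? y ⌋) m (⌊⌋∧⌊⌋-true (x ≤? z) (z ≤? y) l1 l2)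
between⁻ : ∀ {x y V z} → z ∈ between x y V → z ∈ V × x ≤ z × z ≤ y
between⁻ {x} {y} {V} {z} m = let (m' , e) = boolFilter⁻ (λ z → ⌊ x ≤? z ⌋ ∧ ⌊ z ≤? y ⌋) {V} m in m' , ⌊⌋∧⌊⌋-true⁻ (x ≤? z) (z ≤? y) e

module DPDecompose {V : List ℕ} {A : Digraph} (vA : ValidArrows V A) {x y : ℕ} (mo : (x , y) ∈ A) (fo : x < y)
  (om : ∀ {b} → b ∈ A → Forward b → Nests (x , y) b) where

  L M R : List ℕ
  L = atMost x V
  M = between x y V
  R = atLeast y V

  ¬nests-root : ∀ {a} → a ∈ A → ¬ (tail a ≡ head a) → ¬ (x ≤ lo a) → ¬ Nests a (x , y)
  ¬nests-root {a} ma ne xl n with orientation a ne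
  ... | fw fa = xl (≤-trans (≤-reflexive (sym (lo-fwd fo))) (proj₁ (om ma fa)))
  ... | bw ba = noBackNestsFwd vA ma mo ba fo n

  lo-below : ∀ {a} → ¬ (x ≤ lo a) → lo a ≤ lo (x , y)
  lo-below xl = ≤-trans (<⇒≤ (≰⇒> xl)) (≤-reflexive (sym (lo-fwd fo)))

  arrow-cases : ∀ {a} → a ∈ A → a ∈ restrict L A ⊎ a ∈ restrict M A ⊎ a ∈ restrict R A
  arrow-cases {a} ma with arrowsOnV vA ma
  ... | tV , hV , ne with hi a ≤? x
  ... | yes h = inj₁ (restrict⁺ ma (atMost⁺ tV (≤-trans (tail≤hi a) h)) (atMost⁺ hV (≤-trans (head≤hi a) h)))
  ... | no h with y ≤? lo a
  ...   | yes l = inj₂ (inj₂ (restrict⁺ ma (atLeast⁺ tV (≤-trans l (lo≤tail a))) (atLeast⁺ hV (≤-trans l (lo≤head a)))))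
  ...   | no l with x ≤? lo a
  ...     | yes xl with hi a ≤? y
  ...       | yes hy = inj₂ (inj₁ (restrict⁺ ma (between⁺ tV (≤-trans xl (lo≤tail a)) (≤-trans (tail≤hi a) hy)) (between⁺ hV (≤-trans xl (lo≤head a)) (≤-trans (head≤hi a) hy))))
  ...       | no hy with m≤n⇒m<n∨m≡n xl
  ...         | inj₁ xl' = ⊥-elim (noCross vA mo ma (mkCross (x , y) a (lo-fwd fo) (hi-fwd fo) refl refl xl' (≰⇒> l) (≰⇒> hy)))
  ...         | inj₂ xe with orientation a ne
  ...           | fw fa = ⊥-elim (hy (≤-trans (proj₂ (om ma fa)) (≤-reflexive (hi-fwd fo))))
  ...           | bw ba = ⊥-elim (headNotTail vA ma mo (trans (sym (lo-Backward a ba)) (sym xe)))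
  arrow-cases {a} ma | tV , hV , ne | no h | no l | no xl with hi a ≤? y
  ... | no hy = ⊥-elim (¬nests-root ma ne xl (lo-below xl , ≤-trans (≤-reflexive (hi-fwd fo)) (<⇒≤ (≰⇒> hy))))
  ... | yes hy with m≤n⇒m<n∨m≡n hy
  ...   | inj₁ hy' = ⊥-elim (noCross vA ma mo (mkCross a (x , y) refl refl (lo-fwd fo) (hi-fwd fo) (≰⇒> xl) (≰⇒> h) hy'))
  ...   | inj₂ he = ⊥-elim (¬nests-root ma ne xl (lo-below xl , ≤-trans (≤-reflexive (hi-fwd fo)) (≤-reflexive (sym he))))

  backwardsL : Backwards (restrict L A)
  backwardsL {b} m with restrict⁻ {L} {A} m
  ... | mb , tL , hL with arrowsOnV vA mb
  ...   | _ , _ , ne with orientation b ne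
  ...     | bw bb = bb
  ...     | fw fb = ⊥-elim (<-irrefl refl (<-≤-trans (Forward⇒lo<hi b fb)
                (≤-trans (hi-lub b (proj₂ (atMost⁻ {x} {V} tL)) (proj₂ (atMost⁻ {x} {V} hL))) (≤-trans (≤-reflexive (sym (lo-fwd fo))) (proj₁ (om mb fb))))))

  backwardsR : Backwards (restrict R A)
  backwardsR {b} m with restrict⁻ {R} {A} m
  ... | mb , tR , hR with arrowsOnV vA mb
  ...   | _ , _ , ne with orientation b ne
  ...     | bw bb = bb
  ...     | fw fb = ⊥-elim (<-irrefl refl (<-≤-trans (Forward⇒lo<hi b fb)
                (≤-trans (proj₂ (om mb fb)) (≤-trans (≤-reflexive (hi-fwd fo)) (lo-glb b (proj₂ (atLeast⁻ {y} {V} tR)) (proj₂ (atLeast⁻ {y} {V} hR)))))))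

  M-bounds : ∀ {z} → z ∈ M → x ≤ z × z ≤ y
  M-bounds m = proj₂ (between⁻ {x} {y} {V} m)

  x∈M : x ∈ M
  x∈M = between⁺ (proj₁ (arrowsOnV vA mo)) ≤-refl (<⇒≤ fo)
  y∈M : y ∈ M
  y∈M = between⁺ (proj₁ (proj₂ (arrowsOnV vA mo))) (<⇒≤ fo) ≤-refl

  validM : ValidArrows M (restrict M A)
  validM = ValidArrows-restrict {A = A} vA
  xy∈M : (x , y) ∈ restrict M A
  xy∈M = restrict⁺ mo x∈M y∈M

  validTwisted : ValidArrows (twistNodes x M) (twist x y M (restrict M A))
  validTwisted = Twist.Forth.valid fo M-bounds validM xy∈M

dpForward : ℕ → List ℕ → Arrow → Digraph → Word
dpForward k V o A = SP (atMost (tail o) V) (restrict (atMost (tail o) V) A) ++ D ∷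
  dp k (twistNodes (tail o) (between (tail o) (head o) V)) (twist (tail o) (head o) (between (tail o) (head o) V) (restrict (between (tail o) (head o) V) A))
  ++ U ∷ SP (atLeast (head o) V) (restrict (atLeast (head o) V) A)

dp-no-forward : ∀ k V A → forwards A ≡ [] → dp (suc k) V A ≡ SP V A
dp-no-forward k V A e rewrite e = refl

dp-forward : ∀ k V A f fs → forwards A ≡ f ∷ fs → dp (suc k) V A ≡ dpForward k V (outermost f fs) A
dp-forward k V A f fs e rewrite e = refl

dp-≐ : ∀ k V A A' → ValidArrows V A → A ≐ A' → dp k V A ≡ dp k V A'
dp-≐-forwards : ∀ k V A A' → ValidArrows V A → A ≐ A' → ∀ la lb → forwards A ≡ la → forwards A' ≡ lb → dp (suc k) V A ≡ dp (suc k) V A'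
dp-≐ zero V A A' vA e = refl
dp-≐ (suc k) V A A' vA e = dp-≐-forwards k V A A' vA e (forwards A) (forwards A') refl refl
dp-≐-forwards k V A A' vA e [] [] e1 e2 = trans (dp-no-forward k V A e1) (trans (sp-≐ (length V) V A A' e) (sym (dp-no-forward k V A' e2)))
dp-≐-forwards k V A A' vA e [] (f ∷ fs) e1 e2 with forwards⁻ {A'} (subst (f ∈_) (sym e2) (here refl))
... | m , fo with subst (f ∈_) e1 (forwards⁺ (proj₂ e m) fo)
... | ()
dp-≐-forwards k V A A' vA e (f ∷ fs) [] e1 e2 with forwards⁻ {A} (subst (f ∈_) (sym e1) (here refl))
... | m , fo with subst (f ∈_) e2 (forwards⁺ (proj₁ e m) fo)
... | ()
dp-≐-forwards k V A A' vA e (f ∷ fs) (f' ∷ fs') e1 e2 = trans (dp-forward k V A f fs e1) (trans (trans mid (cong (λ p → dpForward k V p A') same-outermost)) (sym (dp-forward k V A' f' fs' e2)))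
  where
  vA' : ValidArrows V A'
  vA' = ValidArrows-≐ vA (≐-sym e)
  o = outermost f fs
  o' = outermost f' fs'
  O = outermost-spec vA e1
  O' = outermost-spec vA' e2
  same-outermost : o ≡ o'
  same-outermost = Forward-Nests-antisym (proj₁ (proj₂ O)) (proj₁ (proj₂ O')) (proj₂ (proj₂ O) (proj₂ e (proj₁ O')) (proj₁ (proj₂ O'))) (proj₂ (proj₂ O') (proj₁ e (proj₁ O)) (proj₁ (proj₂ O)))
  x = tail o
  y = head o
  mid : dpForward k V o A ≡ dpForward k V o A'
  mid = cong₂ (λ a b → a ++ D ∷ b) (sp-≐ (length (atMost x V)) (atMost x V) _ _ (restrict-≐ (atMost x V) e))
          (cong₂ (λ a b → a ++ U ∷ b)
            (dp-≐ k _ _ _ (DPDecompose.validTwisted vA (proj₁ O) (proj₁ (proj₂ O)) (proj₂ (proj₂ O))) (twist-≐ x y (between x y V) (restrict-≐ (between x y V) e)))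
            (sp-≐ (length (atLeast y V)) (atLeast y V) _ _ (restrict-≐ (atLeast y V) e)))

atMost-atMost-pred : ∀ x y a → x ≤ y → ⌊ a ≤? y ⌋ ∧ ⌊ a ≤? x ⌋ ≡ ⌊ a ≤? x ⌋
atMost-atMost-pred x y a l with a ≤? x
... | yes p rewrite ⌊⌋-true (a ≤? y) (≤-trans p l) = refl
... | no _ = ∧-falseʳ ⌊ a ≤? y ⌋ refl

twistNodes-between-pred : ∀ x y a → ⌊ a ≤? y ⌋ ∧ not ⌊ a ≤? x ⌋ ≡ (⌊ x ≤? a ⌋ ∧ ⌊ a ≤? y ⌋) ∧ ⌊ x <? a ⌋
twistNodes-between-pred x y a with x <? a
... | yes p rewrite ⌊⌋-false (a ≤? x) (<⇒≱ p) | ⌊⌋-true (x ≤? a) (<⇒≤ p) = refl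
... | no p rewrite ⌊⌋-true (a ≤? x) (≮⇒≥ p) = trans (∧-falseʳ ⌊ a ≤? y ⌋ refl) (sym (∧-falseʳ (⌊ x ≤? a ⌋ ∧ ⌊ a ≤? y ⌋) refl))

length-atMost-split : ∀ x y V → x ≤ y → length (atMost x V) + length (twistNodes x (between x y V)) ≡ length (atMost y V)
length-atMost-split x y V l = trans (cong₂ _+_ (cong length e1) (cong length e2)) (length-boolFilter-partition (λ z → ⌊ z ≤? x ⌋) (atMost y V))
  where
  e1 : atMost x V ≡ boolFilter (λ z → ⌊ z ≤? x ⌋) (atMost y V)
  e1 = sym (trans (boolFilter-boolFilter _ _ V) (boolFilter-cong _ _ V (λ {a} _ → atMost-atMost-pred x y a l)))
  e2 : twistNodes x (between x y V) ≡ boolFilter (λ z → not ⌊ z ≤? x ⌋) (atMost y V)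
  e2 = trans (boolFilter-boolFilter _ _ V) (sym (trans (boolFilter-boolFilter _ _ V) (boolFilter-cong _ _ V (λ {a} _ → twistNodes-between-pred x y a))))

length-atMost+atLeast : ∀ y V → Sorted V → y ∈ V → length (atMost y V) + length (atLeast y V) ≡ suc (length V)
length-atMost+atLeast y (v ∷ V) (h , s) (here refl)
  rewrite ⌊⌋-true (y ≤? y) ≤-refl | boolFilter-none (λ z → ⌊ z ≤? y ⌋) V (λ m → ⌊⌋-false (_ ≤? y) (<⇒≱ (h m)))
        | boolFilter-all (λ z → ⌊ y ≤? z ⌋) V (λ m → ⌊⌋-true (y ≤? _) (<⇒≤ (h m))) = refl
length-atMost+atLeast y (v ∷ V) (h , s) (there m)
  rewrite ⌊⌋-true (v ≤? y) (<⇒≤ (h m)) | ⌊⌋-false (y ≤? v) (<⇒≱ (h m)) = cong suc (length-atMost+atLeast y V s m)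

atMost-length-mono : ∀ V {x y} → x ≤ y → length (atMost x V) ≤ length (atMost y V)
atMost-length-mono V {x} {y} x≤y = length-boolFilter-mono _ _ V (λ {z} _ q → ⌊⌋-true (z ≤? y) (≤-trans (⌊⌋-true⁻ (z ≤? x) q) x≤y))

atMost-length-reflects-< : ∀ V {x y} → length (atMost x V) < length (atMost y V) → x < y
atMost-length-reflects-< V {x} {y} l = ≰⇒> (λ y≤x → <⇒≱ l (atMost-length-mono V y≤x))

atMost-length-injective : ∀ {V x x'} → x ∈ V → x' ∈ V → length (atMost x V) ≡ length (atMost x' V) → x ≡ x'
atMost-length-injective {V} {x} {x'} m m' e with <-cmp x x'
... | tri≈ _ q _ = q
... | tri< l _ _ = ⊥-elim (<-irrefl e (length-boolFilter-strictMono _ _ V (λ {z} _ q → ⌊⌋-true (z ≤? x') (≤-trans (⌊⌋-true⁻ (z ≤? x) q) (<⇒≤ l))) m' (⌊⌋-false (x' ≤? x) (<⇒≱ l)) (⌊⌋-true (x' ≤? x') ≤-refl)))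
... | tri> _ _ l = ⊥-elim (<-irrefl (sym e) (length-boolFilter-strictMono _ _ V (λ {z} _ q → ⌊⌋-true (z ≤? x) (≤-trans (⌊⌋-true⁻ (z ≤? x') q) (<⇒≤ l))) m (⌊⌋-false (x ≤? x') (<⇒≱ l)) (⌊⌋-true (x ≤? x) ≤-refl)))

atLeast-length-injective : ∀ {V y y'} → y ∈ V → y' ∈ V → length (atLeast y V) ≡ length (atLeast y' V) → y ≡ y'
atLeast-length-injective {V} {y} {y'} m m' e with <-cmp y y'
... | tri≈ _ q _ = q
... | tri< l _ _ = ⊥-elim (<-irrefl (sym e) (length-boolFilter-strictMono _ _ V (λ {z} _ q → ⌊⌋-true (y ≤? z) (≤-trans (<⇒≤ l) (⌊⌋-true⁻ (y' ≤? z) q))) m (⌊⌋-false (y' ≤? y) (<⇒≱ l)) (⌊⌋-true (y ≤? y) ≤-refl)))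
... | tri> _ _ l = ⊥-elim (<-irrefl e (length-boolFilter-strictMono _ _ V (λ {z} _ q → ⌊⌋-true (y' ≤? z) (≤-trans (<⇒≤ l) (⌊⌋-true⁻ (y ≤? z) q))) m' (⌊⌋-false (y ≤? y') (<⇒≱ l)) (⌊⌋-true (y' ≤? y') ≤-refl)))

no-forwards⇒Backwards : ∀ {V A} → ValidArrows V A → forwards A ≡ [] → Backwards A
no-forwards⇒Backwards {V} {A} vA e {a} m with orientation a (proj₂ (proj₂ (arrowsOnV vA m)))
... | bw b = b
... | fw f with subst (a ∈_) e (forwards⁺ m f)
... | ()

suc-parts : ∀ i j r → suc (suc (suc (i + j + r))) ≡ suc (suc (i + j)) + suc r
suc-parts = solve-∀

DU-wlen : ∀ i j r n → (suc i + suc j) + suc r ≡ suc (suc n) → i + i + suc (j + j + suc (r + r)) ≡ n + n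
DU-wlen i j r n e with suc-injective (suc-injective (trans (regroup i j r) e))
  where
  regroup : ∀ i j r → suc (suc (suc (i + j + r))) ≡ (suc i + suc j) + suc r
  regroup = solve-∀
... | refl = DU-double i j r

balanced-DU : ∀ s1 m s2 → countU s1 ≡ countD s1 → countU m ≡ countD m → countU s2 ≡ countD s2 → countU (s1 ++ D ∷ m ++ U ∷ s2) ≡ countD (s1 ++ D ∷ m ++ U ∷ s2)
balanced-DU s1 m s2 e1 e2 e3 rewrite countU-++ s1 (D ∷ m ++ U ∷ s2) | countD-++ s1 (D ∷ m ++ U ∷ s2) | countU-++ m (U ∷ s2) | countD-++ m (U ∷ s2) | e1 | e2 | e3
  = cong (countD s1 +_) (+-suc (countD m) (countD s2))

module DPUnfold {V : List ℕ} {A : Digraph} {f : Arrow} {fs : Digraph} (srt : Sorted V) (vA : ValidArrows V A) (e : forwards A ≡ f ∷ fs) where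
  O = outermost-spec vA e
  o = outermost f fs
  x = tail o
  y = head o
  mo : (x , y) ∈ A
  mo = proj₁ O
  fo : x < y
  fo = proj₁ (proj₂ O)
  om : ∀ {b} → b ∈ A → Forward b → Nests (x , y) b
  om = proj₂ (proj₂ O)
  module D = DPDecompose vA mo fo om
  L = D.L
  M = D.M
  R = D.R
  M' = twistNodes x M
  C = twist x y M (restrict M A)
  xV : x ∈ V
  xV = proj₁ (arrowsOnV vA mo)
  yV : y ∈ V
  yV = proj₁ (proj₂ (arrowsOnV vA mo))
  sortedL : Sorted L
  sortedL = Increasing-boolFilter _ V srt
  sortedR : Sorted R
  sortedR = Increasing-boolFilter _ V srt
  sortedM′ : Sorted M'
  sortedM′ = Increasing-boolFilter _ M (Increasing-boolFilter _ V srt)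
  validL : ValidArrows L (restrict L A)
  validL = ValidArrows-restrict {A = A} vA
  validR : ValidArrows R (restrict R A)
  validR = ValidArrows-restrict {A = A} vA
  lengthL : ∃[ i ] (length L ≡ suc i)
  lengthL = ∈⇒length-suc (atMost⁺ {x} {V} xV ≤-refl)
  lengthR : ∃[ r ] (length R ≡ suc r)
  lengthR = ∈⇒length-suc (atLeast⁺ {y} {V} yV ≤-refl)
  lengthM′ : ∃[ j ] (length M' ≡ suc j)
  lengthM′ = ∈⇒length-suc (Twist.twistNodes⁺ fo D.M-bounds D.y∈M fo)
  M'< : length M' < length V
  M'< = <-≤-trans (length-boolFilter< (λ z → ⌊ x <? z ⌋) M D.x∈M (⌊⌋-false (x <? x) (<-irrefl refl))) (length-boolFilter≤ _ V)
  cnt : (length L + length M') + length R ≡ suc (length V)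
  cnt = trans (cong (_+ length R) (length-atMost-split x y V (<⇒≤ fo))) (length-atMost+atLeast y V srt yV)
  dp-unfold : ∀ k → dp (suc k) V A ≡ SP L (restrict L A) ++ D ∷ dp k M' C ++ U ∷ SP R (restrict R A)
  dp-unfold k = dp-forward k V A f fs e
  SP-L : Schröder (SP L (restrict L A)) × wlen (SP L (restrict L A)) ≡ proj₁ lengthL + proj₁ lengthL
  SP-L = SP-Schröder (length L) L (proj₁ lengthL) (restrict L A) sortedL (proj₂ lengthL) ≤-refl validL D.backwardsL
  SP-R : Schröder (SP R (restrict R A)) × wlen (SP R (restrict R A)) ≡ proj₁ lengthR + proj₁ lengthR
  SP-R = SP-Schröder (length R) R (proj₁ lengthR) (restrict R A) sortedR (proj₂ lengthR) ≤-refl validR D.backwardsR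

DP-balanced : ∀ k V n A → Sorted V → length V ≡ suc n → length V ≤ k → ValidArrows V A → BalancedDelannoy n (dp k V A)
DP-balanced-forwards : ∀ k V n A → Sorted V → length V ≡ suc n → length V ≤ suc k → ValidArrows V A → ∀ la → forwards A ≡ la → BalancedDelannoy n (dp (suc k) V A)
DP-balanced zero V n A s l k≤ vA = ⊥-elim (≡suc⇒≰0 l k≤)
DP-balanced (suc k) V n A s l k≤ vA = DP-balanced-forwards k V n A s l k≤ vA (forwards A) refl
DP-balanced-forwards k V n A s l k≤ vA [] e rewrite dp-no-forward k V A e with SP-Schröder (length V) V n A s l ≤-refl vA (no-forwards⇒Backwards vA e)
... | sc , wl = wl , Schröder-balanced sc
DP-balanced-forwards k V n A s l k≤ vA (f ∷ fs) e rewrite DPUnfold.dp-unfold s vA e k = wl , bal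
  where
  module F = DPUnfold s vA e
  i = proj₁ F.lengthL
  j = proj₁ F.lengthM′
  r = proj₁ F.lengthR
  s1 = F.SP-L
  s2 = F.SP-R
  sm = DP-balanced k F.M' j F.C F.sortedM′ (proj₂ F.lengthM′) (≤-pred (≤-trans F.M'< k≤)) F.D.validTwisted
  cn : (suc i + suc j) + suc r ≡ suc (suc n)
  cn = trans (cong₂ _+_ (cong₂ _+_ (sym (proj₂ F.lengthL)) (sym (proj₂ F.lengthM′))) (sym (proj₂ F.lengthR))) (trans F.cnt (cong suc l))
  wl = trans (wlen-DU (SP F.L (restrict F.L A)) (dp k F.M' F.C) (SP F.R (restrict F.R A)))
         (trans (cong₂ (λ a b → a + suc b) (proj₂ s1) (cong₂ (λ a b → a + suc b) (proj₁ sm) (proj₂ s2))) (DU-wlen i j r n cn))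
  bal = balanced-DU (SP F.L (restrict F.L A)) (dp k F.M' F.C) (SP F.R (restrict F.R A)) (Schröder-balanced (proj₁ s1)) (proj₂ sm) (Schröder-balanced (proj₁ s2))

valid-≐-by-parts : ∀ {V A B x y} → ValidArrows V A → ValidArrows V B → (x , y) ∈ A → x < y → (∀ {b} → b ∈ A → Forward b → Nests (x , y) b) →
  (x , y) ∈ B → (∀ {b} → b ∈ B → Forward b → Nests (x , y) b) →
  restrict (atMost x V) A ≐ restrict (atMost x V) B → restrict (between x y V) A ≐ restrict (between x y V) B →
  restrict (atLeast y V) A ≐ restrict (atLeast y V) B → A ≐ B
valid-≐-by-parts {V} {A} {B} {x} {y} vA vB mA fo omA mB omB eL eM eR = f , g
  where
  f : A ⊆ B
  f m with DPDecompose.arrow-cases vA mA fo omA m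
  ... | inj₁ z = restrict-⊆ {atMost x V} {B} (proj₁ eL z)
  ... | inj₂ (inj₁ z) = restrict-⊆ {between x y V} {B} (proj₁ eM z)
  ... | inj₂ (inj₂ z) = restrict-⊆ {atLeast y V} {B} (proj₁ eR z)
  g : B ⊆ A
  g m with DPDecompose.arrow-cases vB mB fo omB m
  ... | inj₁ z = restrict-⊆ {atMost x V} {A} (proj₂ eL z)
  ... | inj₂ (inj₁ z) = restrict-⊆ {between x y V} {A} (proj₂ eM z)
  ... | inj₂ (inj₂ z) = restrict-⊆ {atLeast y V} {A} (proj₂ eR z)

DP-injective : ∀ k V n A B → Sorted V → length V ≡ suc n → length V ≤ k → ValidArrows V A → ValidArrows V B → dp k V A ≡ dp k V B → A ≐ B
DP-injective-forwards : ∀ k V n A B → Sorted V → length V ≡ suc n → length V ≤ suc k → ValidArrows V A → ValidArrows V B → ∀ la lb → forwards A ≡ la → forwards B ≡ lb →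
  dp (suc k) V A ≡ dp (suc k) V B → A ≐ B
DP-no-forward≢forward : ∀ k V n A B → Sorted V → length V ≡ suc n → ValidArrows V A → ValidArrows V B → ∀ f fs → forwards A ≡ [] → forwards B ≡ f ∷ fs →
  dp (suc k) V A ≢ dp (suc k) V B
DP-injective zero V n A B s l k≤ vA vB eq = ⊥-elim (≡suc⇒≰0 l k≤)
DP-injective (suc k) V n A B s l k≤ vA vB eq = DP-injective-forwards k V n A B s l k≤ vA vB (forwards A) (forwards B) refl refl eq
DP-no-forward≢forward k V n A B s l vA vB f fs eA eB eq = Schröder≢Schröder-D (proj₁ (SP-Schröder (length V) V n A s l ≤-refl vA (no-forwards⇒Backwards vA eA)))
   (proj₁ F.SP-L)
   (trans (sym (dp-no-forward k V A eA)) (trans eq (F.dp-unfold k)))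
  where module F = DPUnfold s vB eB
DP-injective-forwards k V n A B s l k≤ vA vB [] [] eA eB eq = SP-injective (length V) V n A B s l ≤-refl vA (no-forwards⇒Backwards vA eA) vB (no-forwards⇒Backwards vB eB) (trans (sym (dp-no-forward k V A eA)) (trans eq (dp-no-forward k V B eB)))
DP-injective-forwards k V n A B s l k≤ vA vB [] (f ∷ fs) eA eB eq = ⊥-elim (DP-no-forward≢forward k V n A B s l vA vB f fs eA eB eq)
DP-injective-forwards k V n A B s l k≤ vA vB (f ∷ fs) [] eA eB eq = ⊥-elim (DP-no-forward≢forward k V n B A s l vB vA f fs eB eA (sym eq))
DP-injective-forwards k V n A B s l k≤ vA vB (f ∷ fs) (f' ∷ fs') eA eB eq = valid-≐-by-parts vA vB FA.mo FA.fo FA.om mB omB eL eM eR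
  where
  module FA = DPUnfold s vA eA
  module FB = DPUnfold s vB eB
  iA = proj₁ FA.lengthL
  rA = proj₁ FA.lengthR
  split-L = Schröder-D-injective (proj₁ FA.SP-L) (proj₁ FB.SP-L) (trans (sym (FA.dp-unfold k)) (trans eq (FB.dp-unfold k)))
  split-R = U-Schröder-injective (proj₁ FA.SP-R) (proj₁ FB.SP-R) (proj₂ split-L)
  iAB : iA ≡ proj₁ FB.lengthL
  iAB = double-injective _ _ (trans (sym (proj₂ FA.SP-L)) (trans (cong wlen (proj₁ split-L)) (proj₂ FB.SP-L)))
  rAB : rA ≡ proj₁ FB.lengthR
  rAB = double-injective _ _ (trans (sym (proj₂ FA.SP-R)) (trans (cong wlen (proj₂ split-R)) (proj₂ FB.SP-R)))
  xAB : FA.x ≡ FB.x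
  xAB = atMost-length-injective FA.xV FB.xV (trans (proj₂ FA.lengthL) (trans (cong suc iAB) (sym (proj₂ FB.lengthL))))
  yAB : FA.y ≡ FB.y
  yAB = atLeast-length-injective FA.yV FB.yV (trans (proj₂ FA.lengthR) (trans (cong suc rAB) (sym (proj₂ FB.lengthR))))
  x = FA.x
  y = FA.y
  mB : (x , y) ∈ B
  mB = subst₂ (λ a b → (a , b) ∈ B) (sym xAB) (sym yAB) FB.mo
  omB : ∀ {b} → b ∈ B → Forward b → Nests (x , y) b
  omB m f = subst₂ (λ a b → Nests (a , b) _) (sym xAB) (sym yAB) (FB.om m f)
  module DB = DPDecompose vB mB FA.fo omB
  eqL : SP (atMost x V) (restrict (atMost x V) A) ≡ SP (atMost x V) (restrict (atMost x V) B)
  eqL = trans (proj₁ split-L) (cong (λ a → SP (atMost a V) (restrict (atMost a V) B)) (sym xAB))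
  eL : restrict (atMost x V) A ≐ restrict (atMost x V) B
  eL = SP-injective (length FA.L) FA.L iA _ _ FA.sortedL (proj₂ FA.lengthL) ≤-refl FA.validL FA.D.backwardsL (ValidArrows-restrict {A = B} vB) DB.backwardsL eqL
  eqR : SP (atLeast y V) (restrict (atLeast y V) A) ≡ SP (atLeast y V) (restrict (atLeast y V) B)
  eqR = trans (proj₂ split-R) (cong (λ a → SP (atLeast a V) (restrict (atLeast a V) B)) (sym yAB))
  eR : restrict (atLeast y V) A ≐ restrict (atLeast y V) B
  eR = SP-injective (length FA.R) FA.R rA _ _ FA.sortedR (proj₂ FA.lengthR) ≤-refl FA.validR FA.D.backwardsR (ValidArrows-restrict {A = B} vB) DB.backwardsR eqR
  M = between x y V
  eqM : dp k (twistNodes x M) (twist x y M (restrict M A)) ≡ dp k (twistNodes x M) (twist x y M (restrict M B))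
  eqM = trans (proj₁ split-R) (cong₂ (λ a b → dp k (twistNodes a (between a b V)) (twist a b (between a b V) (restrict (between a b V) B))) (sym xAB) (sym yAB))
  eC : twist x y M (restrict M A) ≐ twist x y M (restrict M B)
  eC = DP-injective k FA.M' (proj₁ FA.lengthM′) _ _ FA.sortedM′ (proj₂ FA.lengthM′) (≤-pred (≤-trans FA.M'< k≤)) FA.D.validTwisted DB.validTwisted eqM
  module T = Untwist FA.fo FA.D.M-bounds FA.D.x∈M FA.D.y∈M
  eM : restrict M A ≐ restrict M B
  eM = T.twist-reflects-⊆ FA.D.validM FA.D.xy∈M DB.validM DB.xy∈M eC , T.twist-reflects-⊆ DB.validM DB.xy∈M FA.D.validM FA.D.xy∈M (≐-sym eC)

module DPCompose {V : List ℕ} {x y : ℕ} {A1 Bu A2 : Digraph} (fo : x < y)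
  (vA1 : ValidArrows (atMost x V) A1) (bA1 : Backwards A1) (vBu : ValidArrows (between x y V) Bu) (mxy : (x , y) ∈ Bu)
  (vA2 : ValidArrows (atLeast y V) A2) (bA2 : Backwards A2) where

  A : Digraph
  A = A1 ++ Bu ++ A2

  data Part (a : Arrow) : Set where
    left : a ∈ A1 → Part a
    middle : a ∈ Bu → Part a
    right : a ∈ A2 → Part a

  part : ∀ {a} → a ∈ A → Part a
  part m with ∈-++⁻ A1 m
  ... | inj₁ z = left z
  ... | inj₂ z with ∈-++⁻ Bu z
  ...   | inj₁ z' = middle z'
  ...   | inj₂ z' = right z'

  left⊆ : ∀ {a} → a ∈ A1 → a ∈ A
  left⊆ m = ∈-++⁺ˡ m
  middle⊆ : ∀ {a} → a ∈ Bu → a ∈ A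
  middle⊆ m = ∈-++⁺ʳ A1 (∈-++⁺ˡ m)
  right⊆ : ∀ {a} → a ∈ A2 → a ∈ A
  right⊆ m = ∈-++⁺ʳ A1 (∈-++⁺ʳ Bu m)

  left-bounds : ∀ {a} → a ∈ A1 → head a < tail a × tail a ≤ x
  left-bounds m = bA1 m , proj₂ (atMost⁻ {x} {V} (proj₁ (arrowsOnV vA1 m)))
  middle-bounds : ∀ {a} → a ∈ Bu → (x ≤ tail a × tail a ≤ y) × (x ≤ head a × head a ≤ y)
  middle-bounds m = proj₂ (between⁻ {x} {y} {V} (proj₁ (arrowsOnV vBu m))) , proj₂ (between⁻ {x} {y} {V} (proj₁ (proj₂ (arrowsOnV vBu m))))
  right-bounds : ∀ {a} → a ∈ A2 → head a < tail a × y ≤ head a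
  right-bounds m = bA2 m , proj₂ (atLeast⁻ {y} {V} (proj₁ (proj₂ (arrowsOnV vA2 m))))

  left-hi : ∀ {a} → a ∈ A1 → hi a ≤ x
  left-hi {a} m = let (l1 , l2) = left-bounds m in hi-lub a l2 (<⇒≤ (<-≤-trans l1 l2))
  middle-lo : ∀ {a} → a ∈ Bu → x ≤ lo a
  middle-lo {a} m = let ((l1 , _) , (l3 , _)) = middle-bounds m in lo-glb a l1 l3
  middle-hi : ∀ {a} → a ∈ Bu → hi a ≤ y
  middle-hi {a} m = let ((_ , l2) , (_ , l4)) = middle-bounds m in hi-lub a l2 l4
  right-lo : ∀ {a} → a ∈ A2 → y ≤ lo a
  right-lo {a} m = let (l1 , l2) = right-bounds m in lo-glb a (≤-trans l2 (<⇒≤ l1)) l2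

  valid : ValidArrows V A
  valid = record { arrowsOnV = ov ; noCross = nc ; fwdNest = fn ; noBackNestsFwd = bn ; headNotTail = ht }
    where
    ov : ∀ {a} → a ∈ A → tail a ∈ V × head a ∈ V × ¬ (tail a ≡ head a)
    ov m with part m
    ... | left z = let (a , b , c) = arrowsOnV vA1 z in proj₁ (atMost⁻ {x} {V} a) , proj₁ (atMost⁻ {x} {V} b) , c
    ... | middle z = let (a , b , c) = arrowsOnV vBu z in proj₁ (between⁻ {x} {y} {V} a) , proj₁ (between⁻ {x} {y} {V} b) , c
    ... | right z = let (a , b , c) = arrowsOnV vA2 z in proj₁ (atLeast⁻ {y} {V} a) , proj₁ (atLeast⁻ {y} {V} b) , c
    nc : ∀ {a b} → a ∈ A → b ∈ A → ¬ Cross a b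
    nc {a} {b} ma mb with part ma | part mb
    ... | left z | left z' = noCross vA1 z z'
    ... | middle z | middle z' = noCross vBu z z'
    ... | right z | right z' = noCross vA2 z z'
    ... | left z | middle z' = disjoint⇒¬Cross a b (≤-trans (left-hi z) (middle-lo z'))
    ... | left z | right z' = disjoint⇒¬Cross a b (≤-trans (left-hi z) (≤-trans (<⇒≤ fo) (right-lo z')))
    ... | middle z | right z' = disjoint⇒¬Cross a b (≤-trans (middle-hi z) (right-lo z'))
    ... | middle z | left z' = disjoint⇒¬Cross′ a b (≤-trans (left-hi z') (middle-lo z))
    ... | right z | left z' = disjoint⇒¬Cross′ a b (≤-trans (left-hi z') (≤-trans (<⇒≤ fo) (right-lo z)))
    ... | right z | middle z' = disjoint⇒¬Cross′ a b (≤-trans (middle-hi z') (right-lo z))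
    forward⇒middle : ∀ {a} → a ∈ A → Forward a → a ∈ Bu
    forward⇒middle m fa with part m
    ... | left z = ⊥-elim (<-asym fa (bA1 z))
    ... | middle z = z
    ... | right z = ⊥-elim (<-asym fa (bA2 z))
    fn : ∀ {a b} → a ∈ A → b ∈ A → Forward a → Forward b → Nests a b ⊎ Nests b a
    fn ma mb fa fb = fwdNest vBu (forward⇒middle ma fa) (forward⇒middle mb fb) fa fb
    bn : ∀ {a b} → a ∈ A → b ∈ A → Backward a → Forward b → ¬ Nests a b
    bn {a} {b} ma mb ba fb with part ma | forward⇒middle mb fb
    ... | left z | z' = disjoint⇒¬Nests a b (Forward⇒lo<hi b fb) (≤-trans (left-hi z) (middle-lo z'))
    ... | middle z | z' = noBackNestsFwd vBu z z' ba fb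
    ... | right z | z' = disjoint⇒¬Nests′ b a (Forward⇒lo<hi b fb) (≤-trans (middle-hi z') (right-lo z))
    ht : ∀ {a b} → a ∈ A → b ∈ A → ¬ (head a ≡ tail b)
    ht {a} {b} ma mb e with part ma | part mb
    ... | left z | left z' = headNotTail vA1 z z' e
    ... | middle z | middle z' = headNotTail vBu z z' e
    ... | right z | right z' = headNotTail vA2 z z' e
    ... | left z | middle z' = let (l1 , l2) = left-bounds z in <-irrefl e (<-≤-trans (<-≤-trans l1 l2) (proj₁ (proj₁ (middle-bounds z'))))
    ... | left z | right z' = let (l1 , l2) = left-bounds z in let (k1 , k2) = right-bounds z' in <-irrefl e (<-trans (<-trans (<-≤-trans l1 l2) fo) (≤-<-trans k2 k1))
    ... | middle z | left z' = headNotTail vBu z mxy (≤-antisym (≤-trans (≤-reflexive e) (proj₂ (left-bounds z'))) (proj₁ (proj₂ (middle-bounds z))))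
    ... | middle z | right z' = let (k1 , k2) = right-bounds z' in <-irrefl e (≤-<-trans (proj₂ (proj₂ (middle-bounds z))) (≤-<-trans k2 k1))
    ... | right z | left z' = let (k1 , k2) = right-bounds z in <-irrefl (sym e) (≤-<-trans (proj₂ (left-bounds z')) (<-≤-trans fo k2))
    ... | right z | middle z' = headNotTail vBu mxy z' (≤-antisym (≤-trans (proj₂ (right-bounds z)) (≤-reflexive e)) (proj₂ (proj₁ (middle-bounds z'))))

  root∈ : (x , y) ∈ A
  root∈ = middle⊆ mxy

  root-nests : ∀ {b} → b ∈ A → Forward b → Nests (x , y) b
  root-nests {b} m fb with part m
  ... | left z = ⊥-elim (<-asym fb (bA1 z))
  ... | middle z = ≤-trans (≤-reflexive (lo-fwd fo)) (middle-lo z) , ≤-trans (middle-hi z) (≤-reflexive (sym (hi-fwd fo)))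
  ... | right z = ⊥-elim (<-asym fb (bA2 z))

  outermost≡root : ∀ {f fs} → forwards A ≡ f ∷ fs → outermost f fs ≡ (x , y)
  outermost≡root e with outermost-spec valid e
  ... | mo , fo' , om' = Forward-Nests-antisym fo' fo (om' root∈ fo) (root-nests mo fo')

  distinct : ∀ {a} → a ∈ A → ¬ (tail a ≡ head a)
  distinct m = proj₂ (proj₂ (ValidArrows.arrowsOnV valid m))

  restrict-left : restrict (atMost x V) A ≐ A1
  restrict-left = f , (λ m → let (a , b , _) = arrowsOnV vA1 m in restrict⁺ (left⊆ m) a b)
    where
    f : restrict (atMost x V) A ⊆ A1
    f m with restrict⁻ {atMost x V} {A} m
    ... | ma , tL , hL with part ma
    ...   | left z = z
    ...   | middle z = ⊥-elim (distinct ma (trans (≤-antisym (proj₂ (atMost⁻ {x} {V} tL)) (proj₁ (proj₁ (middle-bounds z)))) (sym (≤-antisym (proj₂ (atMost⁻ {x} {V} hL)) (proj₁ (proj₂ (middle-bounds z)))))))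
    ...   | right z = ⊥-elim (<-irrefl refl (<-≤-trans fo (≤-trans (proj₂ (right-bounds z)) (proj₂ (atMost⁻ {x} {V} hL)))))

  restrict-middle : restrict (between x y V) A ≐ Bu
  restrict-middle = f , (λ m → let (a , b , _) = arrowsOnV vBu m in restrict⁺ (middle⊆ m) a b)
    where
    f : restrict (between x y V) A ⊆ Bu
    f m with restrict⁻ {between x y V} {A} m
    ... | ma , tM , hM with part ma
    ...   | middle z = z
    ...   | left z = ⊥-elim (distinct ma (trans (≤-antisym (proj₂ (left-bounds z)) (proj₁ (proj₂ (between⁻ {x} {y} {V} tM)))) (sym (≤-antisym (<⇒≤ (<-≤-trans (proj₁ (left-bounds z)) (proj₂ (left-bounds z)))) (proj₁ (proj₂ (between⁻ {x} {y} {V} hM)))))))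
    ...   | right z = ⊥-elim (distinct ma (trans (≤-antisym (proj₂ (proj₂ (between⁻ {x} {y} {V} tM))) (≤-trans (proj₂ (right-bounds z)) (<⇒≤ (proj₁ (right-bounds z))))) (sym (≤-antisym (proj₂ (proj₂ (between⁻ {x} {y} {V} hM))) (proj₂ (right-bounds z))))))

  restrict-right : restrict (atLeast y V) A ≐ A2
  restrict-right = f , (λ m → let (a , b , _) = arrowsOnV vA2 m in restrict⁺ (right⊆ m) a b)
    where
    f : restrict (atLeast y V) A ⊆ A2
    f m with restrict⁻ {atLeast y V} {A} m
    ... | ma , tR , hR with part ma
    ...   | right z = z
    ...   | left z = ⊥-elim (<-irrefl refl (<-≤-trans fo (≤-trans (proj₂ (atLeast⁻ {y} {V} tR)) (proj₂ (left-bounds z)))))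
    ...   | middle z = ⊥-elim (distinct ma (trans (≤-antisym (proj₂ (proj₁ (middle-bounds z))) (proj₂ (atLeast⁻ {y} {V} tR))) (sym (≤-antisym (proj₂ (proj₂ (middle-bounds z))) (proj₂ (atLeast⁻ {y} {V} hR))))))

balanced-DU⁻ : ∀ s1 m s2 → countU s1 ≡ countD s1 → countU s2 ≡ countD s2 → countU (s1 ++ D ∷ m ++ U ∷ s2) ≡ countD (s1 ++ D ∷ m ++ U ∷ s2) → countU m ≡ countD m
balanced-DU⁻ s1 m s2 e1 e3 e rewrite countU-++ s1 (D ∷ m ++ U ∷ s2) | countD-++ s1 (D ∷ m ++ U ∷ s2) | countU-++ m (U ∷ s2) | countD-++ m (U ∷ s2) | e1 | e3
  = +-cancelʳ-≡ (countD s2) _ _ (suc-injective (trans (sym (+-suc (countU m) (countD s2))) (+-cancelˡ-≡ (countD s1) _ _ e)))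

part-lengths : ∀ {V n i j r x y} → Sorted V → length V ≡ suc n → n ≡ suc (i + j + r) → y ∈ V → x < y →
  length (atMost x V) ≡ suc i → length (atMost y V) ≡ suc (suc (i + j)) →
  length (twistNodes x (between x y V)) ≡ suc j × length (atLeast y V) ≡ suc r
part-lengths {V} {n} {i} {j} {r} {x} {y} s l en yV fo lx ly = lM , lR
  where
  lM : length (twistNodes x (between x y V)) ≡ suc j
  lM = +-cancelˡ-≡ (suc i) _ _ (begin
    suc i + length (twistNodes x (between x y V))            ≡⟨ cong (_+ length (twistNodes x (between x y V))) lx ⟨
    length (atMost x V) + length (twistNodes x (between x y V)) ≡⟨ length-atMost-split x y V (<⇒≤ fo) ⟩
    length (atMost y V)                                       ≡⟨ ly ⟩
    suc (suc (i + j))                                         ≡⟨ cong suc (+-suc i j) ⟨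
    suc i + suc j                                             ∎)
    where open ≡-Reasoning
  lR : length (atLeast y V) ≡ suc r
  lR = +-cancelˡ-≡ (suc (suc (i + j))) _ _ (begin
    suc (suc (i + j)) + length (atLeast y V)    ≡⟨ cong (_+ length (atLeast y V)) ly ⟨
    length (atMost y V) + length (atLeast y V)  ≡⟨ length-atMost+atLeast y V s yV ⟩
    suc (length V)                              ≡⟨ cong suc (trans l (cong suc en)) ⟩
    suc (suc (suc (i + j + r)))                 ≡⟨ suc-parts i j r ⟩
    suc (suc (i + j)) + suc r                   ∎)
    where open ≡-Reasoning

DP-surjective : ∀ k V n w → Sorted V → length V ≡ suc n → length V ≤ k → BalancedDelannoy n w → ∃[ A ] (ValidArrows V A × dp k V A ≡ w)
DP-surjective-dip : ∀ k V n s1 m s2 → Sorted V → length V ≡ suc n → length V ≤ suc k → Schröder s1 → Schröder s2 →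
  wlen (s1 ++ D ∷ m ++ U ∷ s2) ≡ n + n → countU m ≡ countD m → ∃[ A ] (ValidArrows V A × dp (suc k) V A ≡ s1 ++ D ∷ m ++ U ∷ s2)
DP-surjective-parts : ∀ k V n s1 m s2 i j r x y → Sorted V → length V ≡ suc n → length V ≤ suc k → Schröder s1 → Schröder s2 → countU m ≡ countD m →
  wlen s1 ≡ i + i → wlen m ≡ j + j → wlen s2 ≡ r + r → n ≡ suc (i + j + r) →
  x ∈ V → length (atMost x V) ≡ suc i → y ∈ V → length (atMost y V) ≡ suc (suc (i + j)) →
  ∃[ A ] (ValidArrows V A × dp (suc k) V A ≡ s1 ++ D ∷ m ++ U ∷ s2)
DP-surjective zero V n w s l k≤ b = ⊥-elim (≡suc⇒≰0 l k≤)
DP-surjective (suc k) V n w s l k≤ (wl , bal) with balancedView w bal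
... | schröder p with SP-surjective (length V) V n w s l ≤-refl p wl
...   | A , vA , bA , e = A , vA , trans (dp-no-forward k V A (boolFilter-none (λ a → ⌊ tail a <? head a ⌋) A (λ {a} m → ⌊⌋-false (tail a <? head a) (<-asym (bA m))))) e
DP-surjective (suc k) V n w s l k≤ (wl , bal) | dip {s1} {m} {s2} p1 p2 = DP-surjective-dip k V n s1 m s2 s l k≤ p1 p2 wl (balanced-DU⁻ s1 m s2 (Schröder-balanced p1) (Schröder-balanced p2) bal)
DP-surjective-dip k V n s1 m s2 s l k≤ p1 p2 wl mb
  with node-with-rank V i s (subst (i <_) (sym l) (s≤s (subst (i ≤_) (sym en) (≤-trans (m≤m+n i j) (≤-trans ijr (n≤1+n _))))))
     | node-with-rank V (suc (i + j)) s (subst (suc (i + j) <_) (sym l) (s≤s (subst (suc (i + j) ≤_) (sym en) (s≤s ijr))))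
  where
  i = halfLength s1
  j = halfLength m
  r = halfLength s2
  en : n ≡ suc (i + j + r)
  en = DU-halfLengths p1 p2 mb wl
  ijr : i + j ≤ i + j + r
  ijr = m≤m+n (i + j) r
... | x , xV , lx | y , yV , ly = DP-surjective-parts k V n s1 m s2 _ _ _ x y s l k≤ p1 p2 mb
        (Schröder-wlen-even p1) (balanced-wlen-even m mb) (Schröder-wlen-even p2) (DU-halfLengths p1 p2 mb wl) xV lx yV ly
DP-surjective-parts k V n s1 m s2 i j r x y s l k≤ p1 p2 mb wi wj wr en xV lx yV ly = A , U.valid , unfolds (forwards A) refl
  where
  ijr : i + j ≤ i + j + r
  ijr = m≤m+n (i + j) r
  fo : x < y
  fo = atMost-length-reflects-< V (subst₂ _<_ (sym lx) (sym ly) (s≤s (s≤s (m≤m+n i j))))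
  L M M' R : List ℕ
  L = atMost x V
  M = between x y V
  M' = twistNodes x M
  R = atLeast y V
  lM' : length M' ≡ suc j
  lM' = proj₁ (part-lengths s l en yV fo lx ly)
  lR : length R ≡ suc r
  lR = proj₂ (part-lengths s l en yV fo lx ly)
  kM : length M' ≤ k
  kM = ≤-trans (≤-reflexive lM') (≤-trans (s≤s (≤-trans (m≤n+m j i) ijr)) (≤-trans (≤-reflexive (sym en)) (≤-pred (≤-trans (≤-reflexive (sym l)) k≤))))
  leftPart : ∃[ A ] (ValidArrows L A × Backwards A × sp (length L) L A ≡ s1)
  leftPart = SP-surjective (length L) L i s1 (Increasing-boolFilter _ V s) lx ≤-refl p1 wi
  rightPart : ∃[ A ] (ValidArrows R A × Backwards A × sp (length R) R A ≡ s2)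
  rightPart = SP-surjective (length R) R r s2 (Increasing-boolFilter _ V s) lR ≤-refl p2 wr
  middlePart : ∃[ A ] (ValidArrows M' A × dp k M' A ≡ m)
  middlePart = DP-surjective k M' j m (Increasing-boolFilter _ M (Increasing-boolFilter _ V s)) lM' kM (wj , mb)
  A1 A2 C : Digraph
  A1 = proj₁ leftPart
  A2 = proj₁ rightPart
  C = proj₁ middlePart
  vA1 : ValidArrows L A1
  vA1 = proj₁ (proj₂ leftPart)
  bA1 : Backwards A1
  bA1 = proj₁ (proj₂ (proj₂ leftPart))
  vA2 : ValidArrows R A2
  vA2 = proj₁ (proj₂ rightPart)
  bA2 : Backwards A2
  bA2 = proj₁ (proj₂ (proj₂ rightPart))
  vC : ValidArrows M' C
  vC = proj₁ (proj₂ middlePart)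
  bnd : ∀ {z} → z ∈ M → x ≤ z × z ≤ y
  bnd mz = proj₂ (between⁻ {x} {y} {V} mz)
  module T = Untwist fo bnd (between⁺ xV ≤-refl (<⇒≤ fo)) (between⁺ yV (<⇒≤ fo) ≤-refl)
  module TB = T.Back vC
  module U = DPCompose {V} fo vA1 bA1 TB.valid TB.root∈ vA2 bA2
  A : Digraph
  A = U.A
  twist-restrict-middle : twist x y M (restrict M A) ≐ C
  twist-restrict-middle = ≐-trans (twist-≐ x y M U.restrict-middle) TB.twist-untwist
  midEq : dp k M' (twist x y M (restrict M A)) ≡ m
  midEq = trans (sym (dp-≐ k M' C (twist x y M (restrict M A)) vC (≐-sym twist-restrict-middle))) (proj₂ (proj₂ middlePart))
  body : dpForward k V (x , y) A ≡ s1 ++ D ∷ m ++ U ∷ s2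
  body = cong₂ (λ a b → a ++ D ∷ b) (trans (sp-≐ (length L) L _ _ U.restrict-left) (proj₂ (proj₂ (proj₂ leftPart))))
           (cong₂ (λ a b → a ++ U ∷ b) midEq (trans (sp-≐ (length R) R _ _ U.restrict-right) (proj₂ (proj₂ (proj₂ rightPart)))))
  unfolds : ∀ la → forwards A ≡ la → dp (suc k) V A ≡ s1 ++ D ∷ m ++ U ∷ s2
  unfolds [] e' with subst ((x , y) ∈_) e' (forwards⁺ U.root∈ fo)
  ... | ()
  unfolds (f ∷ fs) e' = trans (dp-forward k V A f fs e') (trans (cong (λ o → dpForward k V o A) (U.outermost≡root e')) body)

_≟ₐ_ : (a b : Arrow) → Dec (a ≡ b)
_≟ₐ_ = ≡-dec _≟_ _≟_

open DecMembership _≟ₐ_ using () renaming (_∈?_ to _∈?ₐ_)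

<ₐ-trans : ∀ {a b c} → a <ₐ b → b <ₐ c → a <ₐ c
<ₐ-trans {a1 , a2} {b1 , b2} {c1 , c2} (inj₁ x) (inj₁ y) = inj₁ (<-trans x y)
<ₐ-trans {a1 , a2} {b1 , b2} {c1 , c2} (inj₁ x) (inj₂ (refl , _)) = inj₁ x
<ₐ-trans {a1 , a2} {b1 , b2} {c1 , c2} (inj₂ (refl , _)) (inj₁ y) = inj₁ y
<ₐ-trans {a1 , a2} {b1 , b2} {c1 , c2} (inj₂ (refl , x)) (inj₂ (refl , y)) = inj₂ (refl , <-trans x y)

<ₐ-irrefl : ∀ {a} → a <ₐ a → ⊥
<ₐ-irrefl {a1 , a2} (inj₁ x) = <-irrefl refl x
<ₐ-irrefl {a1 , a2} (inj₂ (_ , x)) = <-irrefl refl x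

SortedArrows : List Arrow → Set
SortedArrows = Increasing _<ₐ_

SortedArrows-≐⇒≡ : ∀ {A B} → SortedArrows A → SortedArrows B → A ≐ B → A ≡ B
SortedArrows-≐⇒≡ {[]} {[]} _ _ _ = refl
SortedArrows-≐⇒≡ {[]} {b ∷ B} _ _ (f , g) with g (here refl)
... | ()
SortedArrows-≐⇒≡ {a ∷ A} {[]} _ _ (f , g) with f (here refl)
... | ()
SortedArrows-≐⇒≡ {a ∷ A} {b ∷ B} (ha , sa) (hb , sb) (f , g) with ab
  where
  ab : a ≡ b
  ab with f (here refl) | g (here refl)
  ... | here e | _ = e
  ... | there m | here e = sym e
  ... | there m | there m' = ⊥-elim (<ₐ-irrefl (<ₐ-trans (hb m) (ha m')))
... | refl = cong (a ∷_) (SortedArrows-≐⇒≡ sa sb (f' , g'))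
  where
  f' : A ⊆ B
  f' m with f (there m)
  ... | here refl = ⊥-elim (<ₐ-irrefl (ha m))
  ... | there m' = m'
  g' : B ⊆ A
  g' m with g (there m)
  ... | here refl = ⊥-elim (<ₐ-irrefl (hb m))
  ... | there m' = m'

SortedArrows-++ : ∀ {xs ys} → SortedArrows xs → SortedArrows ys → (∀ {a b} → a ∈ xs → b ∈ ys → a <ₐ b) → SortedArrows (xs ++ ys)
SortedArrows-++ {[]} sx sy h = sy
SortedArrows-++ {x ∷ xs} {ys} (hx , sx) sy h = (λ m → help (∈-++⁻ xs m)) , SortedArrows-++ sx sy (λ a b → h (there a) b)
  where
  help : ∀ {b} → b ∈ xs ⊎ b ∈ ys → x <ₐ b
  help (inj₁ m) = hx m
  help (inj₂ m) = h (here refl) m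

allPairs : List ℕ → List ℕ → List Arrow
allPairs [] W = []
allPairs (p ∷ P) W = map (p ,_) W ++ allPairs P W

allPairs⁻ : ∀ P W {a} → a ∈ allPairs P W → tail a ∈ P
allPairs⁻ (p ∷ P) W m with ∈-++⁻ (map (p ,_) W) m
... | inj₁ m1 with ∈-map⁻ (p ,_) m1
...   | q , _ , refl = here refl
allPairs⁻ (p ∷ P) W m | inj₂ m2 = there (allPairs⁻ P W m2)

allPairs⁺ : ∀ P W {p q} → p ∈ P → q ∈ W → (p , q) ∈ allPairs P W
allPairs⁺ (p ∷ P) W (here refl) mq = ∈-++⁺ˡ (∈-map⁺ (p ,_) mq)
allPairs⁺ (p' ∷ P) W (there mp) mq = ∈-++⁺ʳ (map (p' ,_) W) (allPairs⁺ P W mp mq)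

SortedArrows-map : ∀ p W → Sorted W → SortedArrows (map (p ,_) W)
SortedArrows-map p [] _ = _
SortedArrows-map p (w ∷ W) (h , s) = (λ m → let (q , m' , e) = ∈-map⁻ (p ,_) m in subst ((p , w) <ₐ_) (sym e) (inj₂ (refl , h m'))) , SortedArrows-map p W s

SortedArrows-allPairs : ∀ P W → Sorted P → Sorted W → SortedArrows (allPairs P W)
SortedArrows-allPairs [] W _ _ = _
SortedArrows-allPairs (p ∷ P) W (h , s) sw = SortedArrows-++ (SortedArrows-map p W sw) (SortedArrows-allPairs P W s sw) cross
  where
  cross : ∀ {a b} → a ∈ map (p ,_) W → b ∈ allPairs P W → a <ₐ b
  cross {a} {b} ma mb with ∈-map⁻ (p ,_) ma
  ... | q , _ , refl = inj₁ (h (allPairs⁻ P W mb))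

canonicalForm : List ℕ → Digraph → Digraph
canonicalForm V A = boolFilter (λ a → ⌊ a ∈?ₐ A ⌋) (allPairs V V)

canonicalForm-≐ : ∀ {V A} → ValidArrows V A → canonicalForm V A ≐ A
canonicalForm-≐ {V} {A} vA = (λ {a} m → ⌊⌋-true⁻ (a ∈?ₐ A) (proj₂ (boolFilter⁻ (λ a → ⌊ a ∈?ₐ A ⌋) {allPairs V V} m))) ,
                    (λ {a} m → boolFilter⁺ (λ a → ⌊ a ∈?ₐ A ⌋) (allPairs⁺ V V (proj₁ (arrowsOnV vA m)) (proj₁ (proj₂ (arrowsOnV vA m)))) (⌊⌋-true (a ∈?ₐ A) m))

canonicalForm-sorted : ∀ V A → Sorted V → SortedArrows (canonicalForm V A)
canonicalForm-sorted V A s = Increasing-boolFilter _ (allPairs V V) (SortedArrows-allPairs V V s s)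

ValidDigraph⇒ValidArrows : ∀ {V A} → ValidDigraph V A → ValidArrows V A
ValidDigraph⇒ValidArrows vd = record { arrowsOnV = ValidDigraph.arrowsOnV vd ; noCross = ValidDigraph.noCross vd ; fwdNest = ValidDigraph.fwdNest vd ; noBackNestsFwd = ValidDigraph.noBackNestsFwd vd ; headNotTail = ValidDigraph.headNotTail vd }

ValidArrows⇒ValidDigraph : ∀ {V A} → Linked _<ₐ_ A → ValidArrows V A → ValidDigraph V A
ValidArrows⇒ValidDigraph lk v = record { canonical = lk ; arrowsOnV = arrowsOnV v ; noCross = noCross v ; fwdNest = fwdNest v ; noBackNestsFwd = noBackNestsFwd v ; headNotTail = headNotTail v }

ValidDigraph-≐⇒≡ : ∀ {V A B} → ValidDigraph V A → ValidDigraph V B → A ≐ B → A ≡ B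
ValidDigraph-≐⇒≡ vA vB = SortedArrows-≐⇒≡ (Linked⇒Increasing <ₐ-trans (ValidDigraph.canonical vA)) (Linked⇒Increasing <ₐ-trans (ValidDigraph.canonical vB))

canonicalForm-valid : ∀ {V A} → Sorted V → ValidArrows V A → ValidDigraph V (canonicalForm V A)
canonicalForm-valid {V} {A} s vA = ValidArrows⇒ValidDigraph (Increasing⇒Linked (canonicalForm-sorted V A s)) (ValidArrows-≐ vA (canonicalForm-≐ vA))

theorem8p7 : (n : ℕ) (V : List ℕ) → NodeSet V → length V ≡ suc n →
    (∀ A → ValidDigraph V A → BalancedDelannoy n (DP V A))
    × (∀ A B → ValidDigraph V A → ValidDigraph V B → DP V A ≡ DP V B → A ≡ B)
    × (∀ w → BalancedDelannoy n w → ∃ λ A → ValidDigraph V A × DP V A ≡ w)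
theorem8p7 n V (lk , _) len = balanced , injective , surjective
  where
  sorted : Sorted V
  sorted = Linked⇒Increasing <-trans lk
  balanced : ∀ A → ValidDigraph V A → BalancedDelannoy n (DP V A)
  balanced A vA = DP-balanced (length V) V n A sorted len ≤-refl (ValidDigraph⇒ValidArrows vA)
  injective : ∀ A B → ValidDigraph V A → ValidDigraph V B → DP V A ≡ DP V B → A ≡ B
  injective A B vA vB eq = ValidDigraph-≐⇒≡ vA vB
    (DP-injective (length V) V n A B sorted len ≤-refl (ValidDigraph⇒ValidArrows vA) (ValidDigraph⇒ValidArrows vB) eq)
  surjective : ∀ w → BalancedDelannoy n w → ∃ λ A → ValidDigraph V A × DP V A ≡ w
  surjective w bal with DP-surjective (length V) V n w sorted len ≤-refl bal
  ... | A , vA , e = canonicalForm V A , canonicalForm-valid sorted vA ,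
                     trans (dp-≐ (length V) V _ A (ValidDigraph⇒ValidArrows (canonicalForm-valid sorted vA)) (canonicalForm-≐ vA)) e
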